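{- Let $G$ be a $t$-transmission regular complete multipartite graph with $m\ge 2$ parts, each of size $s\ge 2$ (so $t=ms+s-2$), and let $a=\gcd(m-1,2(s-1))$. Then the Smith normal form of $A^{\operatorname{trs}}(G)$ is $$\operatorname{diag}\big(\mathbf{1}_{(m-1)},\,a,\,t\mathbf{1}_{(ms-2m)},\,2t,\,t(t+s)\mathbf{1}_{(m-2)},\,\tfrac{(s-1)t(t+s)}{a}\big)$$ if $m$ and $s$ are both even, and $$\operatorname{diag}\big(\mathbf{1}_{(m-1)},\,a,\,t\mathbf{1}_{(ms-2m)},\,t,\,t(t+s)\mathbf{1}_{(m-2)},\,\tfrac{2(s-1)t(t+s)}{a}\big)$$ otherwise.
   Context: For a connected graph $G$ with adjacency matrix $A$ and transmission vector $\operatorname{trs}(G)$ ($\operatorname{trs}(v)=\sum_u d(u,v)$), $A^{\operatorname{trs}}(G)=\operatorname{diag}(\operatorname{trs}(G))-A$. $G$ is $t$-transmission regular if $\operatorname{trs}(v)=t$ for all $v$. Smith normal forms are over $\mathbb{Z}$. In a diagonal list, $c\,\mathbf{1}_{(k)}$ denotes $k$ consecutive diagonal entries equal to $c$. -}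

module Defs where

open import Data.Bool using (Bool; true; false; not; if_then_else_; T)
open import Data.Nat as ℕ using (ℕ; zero; suc; _∸_; _≤_)
open import Data.Nat.DivMod using (_/_)
open import Data.Nat.GCD using (gcd)
open import Data.Integer as ℤ using (ℤ; +_; -_; _+_; _*_)
open import Data.Integer.Divisibility using () renaming (_∣_ to _∣ℤ_)
open import Data.Fin using (Fin; zero; suc; toℕ; quotient; _≟_)
open import Data.List using (List; []; _∷_; _++_; replicate; length)
open import Data.List.Relation.Unary.All using (All)
open import Data.List.Relation.Unary.Linked using (Linked)
open import Data.Product using (Σ; _×_; ∃)
open import Relation.Nullary using (does)
open import Relation.Binary.PropositionalEquality using (_≡_)

Adj : ℕ → Set
Adj n = Fin n → Fin n → Bool

data Walk {n : ℕ} (adj : Adj n) : Fin n → Fin n → ℕ → Set where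
  here : ∀ {u} → Walk adj u u zero
  step : ∀ {u w v k} → T (adj u w) → Walk adj w v k → Walk adj u v (suc k)

IsDistance : ∀ {n} → Adj n → (Fin n → Fin n → ℕ) → Set
IsDistance {n} adj d =
  ∀ (u v : Fin n) → Walk adj u v (d u v) × (∀ k → Walk adj u v k → d u v ≤ k)

Matrix : ℕ → Set
Matrix n = Fin n → Fin n → ℤ

Σℤ : ∀ {n} → (Fin n → ℤ) → ℤ
Σℤ {zero}  f = + 0
Σℤ {suc n} f = f zero + Σℤ (λ i → f (suc i))

Σℕ : ∀ {n} → (Fin n → ℕ) → ℕ
Σℕ {zero}  f = 0
Σℕ {suc n} f = f zero ℕ.+ Σℕ (λ i → f (suc i))

_⊗_ : ∀ {n} → Matrix n → Matrix n → Matrix n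
(A ⊗ B) i j = Σℤ (λ k → A i k * B k j)

δ : ∀ {n} → Fin n → Fin n → Bool
δ i j = does (i ≟ j)

I : ∀ {n} → Matrix n
I i j = if δ i j then + 1 else + 0

_≐_ : ∀ {n} → Matrix n → Matrix n → Set
A ≐ B = ∀ i j → A i j ≡ B i j

Unimodular : ∀ {n} → Matrix n → Set
Unimodular {n} P = Σ (Matrix n) λ Q → (P ⊗ Q) ≐ I × (Q ⊗ P) ≐ I

-- k-th entry of a list (0 if out of range)
nth : List ℤ → ℕ → ℤ
nth []       _       = + 0
nth (x ∷ xs) zero    = x
nth (x ∷ xs) (suc k) = nth xs k

diagL : ∀ {n} → List ℤ → Matrix n
diagL ds i j = if δ i j then nth ds (toℕ i) else + 0

IsSNF : ∀ {n} → Matrix n → List ℤ → Set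
IsSNF {n} A ds =
  length ds ≡ n ×
  All (ℤ._≤_ (+ 0)) ds ×
  Linked _∣ℤ_ ds ×
  ∃ λ P → ∃ λ Q → Unimodular P × Unimodular Q × ((P ⊗ A) ⊗ Q) ≐ diagL ds

trs : ∀ {n} → (Fin n → Fin n → ℕ) → Fin n → ℕ
trs d v = Σℕ (λ u → d u v)

Atrs : ∀ {n} → Adj n → (Fin n → Fin n → ℕ) → Matrix n
Atrs adj d i j =
  (if δ i j then + (trs d i) else + 0) ℤ.- (if adj i j then + 1 else + 0)

multipartite : (m s : ℕ) → Adj (m ℕ.* s)
multipartite m s i j = not (does (quotient {m} s i ≟ quotient {m} s j))

tOf : ℕ → ℕ → ℕ
tOf m s = m ℕ.* s ℕ.+ s ∸ 2

aOf : ℕ → ℕ → ℕ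
aOf m s = gcd (m ∸ 1) (2 ℕ.* (s ∸ 1))

-- exact division helper (divisor is nonzero in our use)
divBy : ℕ → ℕ → ℕ
divBy x zero    = 0
divBy x (suc k) = x / suc k

snfEven : ℕ → ℕ → List ℤ
snfEven m s =
  replicate (m ∸ 1) (+ 1) ++ (+ a) ∷ replicate (m ℕ.* s ∸ 2 ℕ.* m) (+ t) ++
  (+ (2 ℕ.* t)) ∷ replicate (m ∸ 2) (+ (t ℕ.* (t ℕ.+ s))) ++
  (+ divBy ((s ∸ 1) ℕ.* t ℕ.* (t ℕ.+ s)) a) ∷ []
  where t = tOf m s
        a = aOf m s

snfOther : ℕ → ℕ → List ℤ
snfOther m s =
  replicate (m ∸ 1) (+ 1) ++ (+ a) ∷ replicate (m ℕ.* s ∸ 2 ℕ.* m) (+ t) ++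
  (+ t) ∷ replicate (m ∸ 2) (+ (t ℕ.* (t ℕ.+ s))) ++
  (+ divBy (2 ℕ.* (s ∸ 1) ℕ.* t ℕ.* (t ℕ.+ s)) a) ∷ []
  where t = tOf m s
        a = aOf m s

module Submission where

-- Every vertex is at distance 1 from the (m − 1) s vertices of the other parts and at distance 2
-- from the s − 1 other vertices of its own part, so G is t-transmission regular and, indexing the
-- vertices by pairs (part , position), A^trs(G) = t I − (J_m − I_m) ⊗ J_s.  Explicit unimodular row
-- and column operations diagonalise this matrix.  Subtracting inside the parts splits off t I of
-- size m (s − 2) and m − 1 unit pivots; the rest is handled by two Bézout steps.  The first combines
-- the pivots m − 1 and t − s (m − 1) = 2 (s − 1) into a = gcd (m − 1) (2 (s − 1)).  Writing
-- u = (m − 1) / a and v = 2 (s − 1) / a, the second produces the entry g t with g = gcd v (u s),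
-- which is 2 when m and s are both even and 1 otherwise, and leaves (v / g) t (t + s) in the last
-- position; m − 2 further entries are t (t + s).  Permuting the diagonal gives the stated order, and
-- the divisibility chain 1 ∣ a ∣ t ∣ g t ∣ t (t + s) ∣ (v / g) t (t + s) holds as a ∣ t and g ∣ t + s.

open import Defs

module _ where
  open import Data.Bool using (Bool; true; false; _∧_; not; if_then_else_; T)
  open import Data.Bool.Properties using (∧-identityʳ)
  open import Data.Unit using (tt)
  open import Data.Empty using (⊥; ⊥-elim)
  open import Data.Nat as ℕ using (ℕ; _≤_; zero; suc; z≤n; s≤s; _∸_; NonZero)
  import Data.Nat.Properties as ℕP
  open import Data.Nat.DivMod using (m*n/n≡m)
  open import Data.Nat.Divisibility using (_∣_; divides; ∣-refl; ∣-trans; 1∣_)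
  open import Data.Nat.GCD using (gcd[m,n]∣m; gcd[m,n]∣n; gcd-greatest; gcd[m,n]≢0; gcd-GCD; module Bézout)
  import Data.Nat.Tactic.RingSolver as NS
  open import Data.Integer as ℤ using (ℤ; +_; -_; _+_; _*_; _-_)
  import Data.Integer.Properties as ℤP
  open import Data.Integer.Divisibility using () renaming (_∣_ to _∣ℤ_)
  open import Data.Integer.Tactic.RingSolver
  open import Data.Fin using (Fin; zero; suc; _↑ˡ_; _↑ʳ_; combine; remQuot; splitAt; join; cast; toℕ)
  open import Data.Fin.Properties using (remQuot-combine; combine-remQuot; splitAt-↑ˡ; splitAt-↑ʳ; join-splitAt; toℕ-cast; cast-involutive; toℕ-↑ˡ; toℕ-↑ʳ)
  open import Data.List using (List; []; _∷_; _++_; replicate; length)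
  open import Data.List.Relation.Unary.All using (All; []; _∷_)
  open import Data.List.Relation.Unary.Linked using (Linked; [-]; _∷_)
  open import Data.Product using (Σ; _×_; _,_; proj₁; proj₂; ∃; uncurry)
  open import Data.Sum using (_⊎_; inj₁; inj₂)
  open import Relation.Nullary using (¬_)
  open import Relation.Binary.PropositionalEquality

  module Equivalence where

    ind : Bool → ℤ
    ind b = if b then + 1 else + 0

    Σ-cong : ∀ {n} {f g : Fin n → ℤ} → (∀ k → f k ≡ g k) → Σℤ f ≡ Σℤ g
    Σ-cong {zero} h = refl
    Σ-cong {suc n} h = cong₂ _+_ (h zero) (Σ-cong (λ k → h (suc k)))

    Σ-+ : ∀ {n} (f g : Fin n → ℤ) → Σℤ (λ k → f k + g k) ≡ Σℤ f + Σℤ g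
    Σ-+ {zero} f g = refl
    Σ-+ {suc n} f g rewrite Σ-+ (λ k → f (suc k)) (λ k → g (suc k)) =
      lem (f zero) (g zero) (Σℤ (λ k → f (suc k))) (Σℤ (λ k → g (suc k)))
      where lem : ∀ a b c d → (a + b) + (c + d) ≡ (a + c) + (b + d)
            lem = solve-∀

    Σ-* : ∀ {n} (c : ℤ) (f : Fin n → ℤ) → Σℤ (λ k → c * f k) ≡ c * Σℤ f
    Σ-* {zero} c f = sym (ℤP.*-zeroʳ c)
    Σ-* {suc n} c f rewrite Σ-* c (λ k → f (suc k)) = sym (ℤP.*-distribˡ-+ c (f zero) _)

    Σ-*ʳ : ∀ {n} (c : ℤ) (f : Fin n → ℤ) → Σℤ (λ k → f k * c) ≡ Σℤ f * c
    Σ-*ʳ c f = trans (Σ-cong (λ k → ℤP.*-comm (f k) c)) (trans (Σ-* c f) (ℤP.*-comm c _))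

    Σ-0 : ∀ {n} → Σℤ {n} (λ _ → + 0) ≡ + 0
    Σ-0 {zero} = refl
    Σ-0 {suc n} rewrite Σ-0 {n} = refl

    Σ-const : ∀ {n} (c : ℤ) → Σℤ {n} (λ _ → c) ≡ + n * c
    Σ-const {zero} c = sym (ℤP.*-zeroˡ c)
    Σ-const {suc n} c rewrite Σ-const {n} c = lem c (+ n)
      where lem : ∀ c n → c + n * c ≡ (+ 1 + n) * c
            lem = solve-∀

    Σ-swap : ∀ {a b} (f : Fin a → Fin b → ℤ) →
             Σℤ (λ i → Σℤ (λ j → f i j)) ≡ Σℤ (λ j → Σℤ (λ i → f i j))
    Σ-swap {zero} {b} f = sym (Σ-0 {b})
    Σ-swap {suc a} f rewrite Σ-swap (λ i j → f (suc i) j) =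
      sym (Σ-+ (λ j → f zero j) (λ j → Σℤ (λ i → f (suc i) j)))

    Σ-δ : ∀ {n} (i : Fin n) (f : Fin n → ℤ) → Σℤ (λ k → ind (δ i k) * f k) ≡ f i
    Σ-δ {suc n} zero f = trans (cong (_+_ (+ 1 * f zero)) (trans (Σ-cong (λ k → ℤP.*-zeroˡ (f (suc k)))) (Σ-0 {n})))
                          (trans (ℤP.+-identityʳ _) (ℤP.*-identityˡ _))
    Σ-δ {suc n} (suc i) f = trans (ℤP.+-identityˡ _) (Σ-δ i (λ k → f (suc k)))

    Σ-δ' : ∀ {n} (i : Fin n) (f : Fin n → ℤ) → Σℤ (λ k → f k * ind (δ k i)) ≡ f i
    Σ-δ' {suc n} zero f = trans (cong (_+_ (f zero * + 1)) (trans (Σ-cong (λ k → ℤP.*-zeroʳ (f (suc k)))) (Σ-0 {n})))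
                          (trans (ℤP.+-identityʳ _) (ℤP.*-identityʳ _))
    Σ-δ' {suc n} (suc i) f = trans (cong (_+ Σℤ (λ k → f (suc k) * ind (δ k i))) (ℤP.*-zeroʳ (f zero))) (trans (ℤP.+-identityˡ _) (Σ-δ' i (λ k → f (suc k))))

    -- Matrices are indexed by an abstract finite type with a summation operator, so that the
    -- reduction can work on Fin m × Fin s and be transported to Fin (m * s) afterwards.
    record FiniteIndex : Set₁ where
      field
        C : Set
        S : (C → ℤ) → ℤ
        eqb : C → C → Bool
        S-cong : ∀ {f g : C → ℤ} → (∀ k → f k ≡ g k) → S f ≡ S g
        S-+ : ∀ (f g : C → ℤ) → S (λ k → f k + g k) ≡ S f + S g
        S-* : ∀ (c : ℤ) (f : C → ℤ) → S (λ k → c * f k) ≡ c * S f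
        S-swap : ∀ (f : C → C → ℤ) → S (λ i → S (λ j → f i j)) ≡ S (λ j → S (λ i → f i j))
        S-δ : ∀ i (f : C → ℤ) → S (λ k → ind (eqb i k) * f k) ≡ f i
        S-δ' : ∀ i (f : C → ℤ) → S (λ k → f k * ind (eqb k i)) ≡ f i
        eqb-refl : ∀ x → eqb x x ≡ true
        eqb-sound : ∀ x y → eqb x y ≡ true → x ≡ y

    module Matrices (X : FiniteIndex) where
      open FiniteIndex X

      Mt : Set
      Mt = C → C → ℤ

      infixl 7 _⊛_
      _⊛_ : Mt → Mt → Mt
      (A ⊛ B) i j = S (λ k → A i k * B k j)

      𝕀 : Mt
      𝕀 i j = if eqb i j then + 1 else + 0

      𝟘 : Mt
      𝟘 i j = + 0

      infix 4 _≑_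
      _≑_ : Mt → Mt → Set
      A ≑ B = ∀ i j → A i j ≡ B i j

      Unimod : Mt → Set
      Unimod P = Σ Mt λ Q → (P ⊛ Q) ≑ 𝕀 × (Q ⊛ P) ≑ 𝕀

      infix 4 _~_
      _~_ : Mt → Mt → Set
      A ~ B = ∃ λ P → ∃ λ Q → Unimod P × Unimod Q × ((P ⊛ A) ⊛ Q) ≑ B

      ᵀ : Mt → Mt
      ᵀ A i j = A j i

      S-*ʳ : ∀ (c : ℤ) (f : C → ℤ) → S (λ k → f k * c) ≡ S f * c
      S-*ʳ c f = trans (S-cong (λ k → ℤP.*-comm (f k) c)) (trans (S-* c f) (ℤP.*-comm c _))

      S-neg : ∀ (f : C → ℤ) → S (λ k → - f k) ≡ - S f
      S-neg f = trans (S-cong (λ k → sym (ℤP.-1*i≡-i (f k)))) (trans (S-* (- + 1) f) (ℤP.-1*i≡-i _))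

      S-- : ∀ (f g : C → ℤ) → S (λ k → f k - g k) ≡ S f - S g
      S-- f g = trans (S-+ f (λ k → - g k)) (cong (_+_ (S f)) (S-neg g))

      ⊛-congˡ : ∀ {A A'} B → A ≑ A' → (A ⊛ B) ≑ (A' ⊛ B)
      ⊛-congˡ B e i j = S-cong (λ k → cong (_* B k j) (e i k))

      ⊛-congʳ : ∀ A {B B'} → B ≑ B' → (A ⊛ B) ≑ (A ⊛ B')
      ⊛-congʳ A e i j = S-cong (λ k → cong (A i k *_) (e k j))

      ⊛-assoc : ∀ A B D → (A ⊛ B ⊛ D) ≑ (A ⊛ (B ⊛ D))
      ⊛-assoc A B D i j =
        begin
          S (λ k → S (λ l → A i l * B l k) * D k j)
        ≡⟨ S-cong (λ k → sym (S-*ʳ (D k j) (λ l → A i l * B l k))) ⟩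
          S (λ k → S (λ l → A i l * B l k * D k j))
        ≡⟨ S-swap _ ⟩
          S (λ l → S (λ k → A i l * B l k * D k j))
        ≡⟨ S-cong (λ l → trans (S-cong (λ k → ℤP.*-assoc (A i l) (B l k) (D k j))) (S-* (A i l) _)) ⟩
          S (λ l → A i l * S (λ k → B l k * D k j))
        ∎
        where open ≡-Reasoning

      𝕀-ˡ : ∀ A → (𝕀 ⊛ A) ≑ A
      𝕀-ˡ A i j = S-δ i (λ k → A k j)

      𝕀-ʳ : ∀ A → (A ⊛ 𝕀) ≑ A
      𝕀-ʳ A i j = S-δ' j (λ k → A i k)

      ≑-trans : ∀ {A B D} → A ≑ B → B ≑ D → A ≑ D
      ≑-trans e f i j = trans (e i j) (f i j)

      ≑-sym : ∀ {A B} → A ≑ B → B ≑ A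
      ≑-sym e i j = sym (e i j)

      𝕀-unimod : Unimod 𝕀
      𝕀-unimod = 𝕀 , 𝕀-ˡ 𝕀 , 𝕀-ˡ 𝕀

      unimod-⊛ : ∀ {P P'} → Unimod P → Unimod P' → Unimod (P ⊛ P')
      unimod-⊛ {P} {P'} (Q , e1 , e2) (Q' , e1' , e2') =
        (Q' ⊛ Q) ,
        ≑-trans (⊛-assoc P P' (Q' ⊛ Q)) (≑-trans (⊛-congʳ P (≑-sym (⊛-assoc P' Q' Q)))
          (≑-trans (⊛-congʳ P (⊛-congˡ Q e1')) (≑-trans (⊛-congʳ P (𝕀-ˡ Q)) e1))) ,
        ≑-trans (⊛-assoc Q' Q (P ⊛ P')) (≑-trans (⊛-congʳ Q' (≑-sym (⊛-assoc Q P P')))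
          (≑-trans (⊛-congʳ Q' (⊛-congˡ P' e2)) (≑-trans (⊛-congʳ Q' (𝕀-ˡ P')) e2')))

      ≑⇒~ : ∀ {A B} → A ≑ B → A ~ B
      ≑⇒~ {A} e = 𝕀 , 𝕀 , 𝕀-unimod , 𝕀-unimod , ≑-trans (𝕀-ʳ (𝕀 ⊛ A)) (≑-trans (𝕀-ˡ A) e)

      ~-trans : ∀ {A B D} → A ~ B → B ~ D → A ~ D
      ~-trans {A} {B} {D} (P , Q , uP , uQ , e) (P' , Q' , uP' , uQ' , e') =
        (P' ⊛ P) , (Q ⊛ Q') , unimod-⊛ uP' uP , unimod-⊛ uQ uQ' ,
        ≑-trans (≑-sym (⊛-assoc (P' ⊛ P ⊛ A) Q Q'))
         (≑-trans (⊛-congˡ Q' (⊛-congˡ Q (⊛-assoc P' P A)))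
          (≑-trans (⊛-congˡ Q' (⊛-assoc P' (P ⊛ A) Q))
           (≑-trans (⊛-congˡ Q' (⊛-congʳ P' e)) e')))

      ~-left : ∀ {A B} P → Unimod P → (P ⊛ A) ≑ B → A ~ B
      ~-left {A} P uP e = P , 𝕀 , uP , 𝕀-unimod , ≑-trans (𝕀-ʳ (P ⊛ A)) e

      ⊛-ᵀ : ∀ A B → ᵀ (A ⊛ B) ≑ (ᵀ B ⊛ ᵀ A)
      ⊛-ᵀ A B i j = S-cong (λ k → ℤP.*-comm (A j k) (B k i))

      eqb-sym : ∀ x y → eqb x y ≡ eqb y x
      eqb-sym x y with eqb x y in e1 | eqb y x in e2
      ... | true | true = refl
      ... | false | false = refl
      ... | true | false with eqb-sound x y e1
      ... | refl = trans (sym (eqb-refl x)) e2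
      eqb-sym x y | false | true with eqb-sound y x e2
      ... | refl = trans (sym e1) (eqb-refl x)

      𝕀ᵀ : ᵀ 𝕀 ≑ 𝕀
      𝕀ᵀ i j = cong (λ b → if b then + 1 else + 0) (eqb-sym j i)

      unimod-ᵀ : ∀ {P} → Unimod P → Unimod (ᵀ P)
      unimod-ᵀ {P} (Q , e1 , e2) = ᵀ Q ,
        (λ i j → trans (sym (⊛-ᵀ Q P i j)) (trans (e2 j i) (𝕀ᵀ i j))) ,
        (λ i j → trans (sym (⊛-ᵀ P Q i j)) (trans (e1 j i) (𝕀ᵀ i j)))

      ~-ᵀ : ∀ {A B} → A ~ B → ᵀ A ~ ᵀ B
      ~-ᵀ {A} {B} (P , Q , uP , uQ , e) = ᵀ Q , ᵀ P , unimod-ᵀ uQ , unimod-ᵀ uP ,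
        λ i j → trans (⊛-assoc (ᵀ Q) (ᵀ A) (ᵀ P) i j)
          (trans (sym (⊛-congʳ (ᵀ Q) (⊛-ᵀ P A) i j)) (trans (sym (⊛-ᵀ (P ⊛ A) Q i j)) (e j i)))

      _⊕_ : Mt → Mt → Mt
      (A ⊕ B) i j = A i j + B i j

      _⊖_ : Mt → Mt → Mt
      (A ⊖ B) i j = A i j - B i j

      ⊕-⊛ : ∀ A B X i j → ((A ⊕ B) ⊛ X) i j ≡ (A ⊛ X) i j + (B ⊛ X) i j
      ⊕-⊛ A B X i j = trans (S-cong (λ k → ℤP.*-distribʳ-+ (X k j) (A i k) (B i k))) (S-+ _ _)

      ⊖-⊛ : ∀ A B X i j → ((A ⊖ B) ⊛ X) i j ≡ (A ⊛ X) i j - (B ⊛ X) i j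
      ⊖-⊛ A B X i j = trans (S-cong (λ k → lem (A i k) (B i k) (X k j))) (S-- _ _)
        where lem : ∀ a b x → (a - b) * x ≡ a * x - b * x
              lem = solve-∀

      ⊛-⊖ : ∀ X A B i j → (X ⊛ (A ⊖ B)) i j ≡ (X ⊛ A) i j - (X ⊛ B) i j
      ⊛-⊖ X A B i j = trans (S-cong (λ k → lem (X i k) (A k j) (B k j))) (S-- _ _)
        where lem : ∀ x a b → x * (a - b) ≡ x * a - x * b
              lem = solve-∀

      ⊛-⊕ : ∀ X A B i j → (X ⊛ (A ⊕ B)) i j ≡ (X ⊛ A) i j + (X ⊛ B) i j
      ⊛-⊕ X A B i j = trans (S-cong (λ k → ℤP.*-distribˡ-+ (X i k) (A k j) (B k j))) (S-+ _ _)

      1+nilpotent-unimod : ∀ N → (N ⊛ N) ≑ 𝟘 → Unimod (𝕀 ⊕ N)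
      1+nilpotent-unimod N N⊛N≑𝟘 = (𝕀 ⊖ N) ,
        (λ i j → trans (⊕-⊛ 𝕀 N (𝕀 ⊖ N) i j)
          (trans (cong₂ _+_ (𝕀-ˡ (𝕀 ⊖ N) i j) (trans (⊛-⊖ N 𝕀 N i j) (cong₂ _-_ (𝕀-ʳ N i j) (N⊛N≑𝟘 i j))))
            (l1 (𝕀 i j) (N i j)))) ,
        (λ i j → trans (⊖-⊛ 𝕀 N (𝕀 ⊕ N) i j)
          (trans (cong₂ _-_ (𝕀-ˡ (𝕀 ⊕ N) i j) (trans (⊛-⊕ N 𝕀 N i j) (cong₂ _+_ (𝕀-ʳ N i j) (N⊛N≑𝟘 i j))))
            (l2 (𝕀 i j) (N i j))))
        where l1 : ∀ a n → (a - n) + (n - + 0) ≡ a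
              l1 = solve-∀
              l2 : ∀ a n → (a + n) - (n + + 0) ≡ a
              l2 = solve-∀

      rowAddNilpotent : ∀ {A} (N : Mt) → (N ⊛ N) ≑ 𝟘 → (B : Mt) →
             (∀ i j → B i j ≡ A i j + (N ⊛ A) i j) → A ~ B
      rowAddNilpotent {A} N N⊛N≑𝟘 B e = ~-left (𝕀 ⊕ N) (1+nilpotent-unimod N N⊛N≑𝟘)
        (λ i j → trans (⊕-⊛ 𝕀 N A i j) (trans (cong (_+ (N ⊛ A) i j) (𝕀-ˡ A i j)) (sym (e i j))))

      colAddNilpotent : ∀ {A} (N : Mt) → (N ⊛ N) ≑ 𝟘 → (B : Mt) →
             (∀ i j → B i j ≡ A i j + (A ⊛ N) i j) → A ~ B
      colAddNilpotent {A} N N⊛N≑𝟘 B e = ~-ᵀ (rowAddNilpotent {ᵀ A} (ᵀ N)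
        (λ i j → trans (sym (⊛-ᵀ N N i j)) (N⊛N≑𝟘 j i)) (ᵀ B)
        (λ i j → trans (e j i) (cong (_+_ (A j i)) (⊛-ᵀ A N i j))))

      sourceMatrix : (C → C) → (C → ℤ) → Mt
      sourceMatrix src coef r k = coef r * ind (eqb (src r) k)

      sourceMatrix-⊛ : ∀ src coef X r c → (sourceMatrix src coef ⊛ X) r c ≡ coef r * X (src r) c
      sourceMatrix-⊛ src coef X r c = trans (S-cong (λ k → ℤP.*-assoc (coef r) _ (X k c)))
        (trans (S-* (coef r) _) (cong (coef r *_) (S-δ (src r) (λ k → X k c))))

      -- row i += coef i · row (src i); the side condition makes its matrix I + N with N ⊛ N = 0
      rowAdd : ∀ {A} (src : C → C) (coef : C → ℤ) → (∀ r → coef r * coef (src r) ≡ + 0) →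
               (B : Mt) → (∀ i j → B i j ≡ A i j + coef i * A (src i) j) → A ~ B
      rowAdd {A} src coef nil B e = rowAddNilpotent (sourceMatrix src coef)
        (λ r c → trans (sourceMatrix-⊛ src coef (sourceMatrix src coef) r c)
          (trans (sym (ℤP.*-assoc (coef r) (coef (src r)) _)) (trans (cong (_* ind (eqb (src (src r)) c)) (nil r)) (ℤP.*-zeroˡ (ind (eqb (src (src r)) c))))))
        B (λ i j → trans (e i j) (cong (_+_ (A i j)) (sym (sourceMatrix-⊛ src coef A i j))))

      colAdd : ∀ {A} (src : C → C) (coef : C → ℤ) → (∀ r → coef r * coef (src r) ≡ + 0) →
               (B : Mt) → (∀ i j → B i j ≡ A i j + A i (src j) * coef j) → A ~ B
      colAdd {A} src coef nil B e = ~-ᵀ (rowAdd {ᵀ A} src coef nil (ᵀ B)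
        (λ i j → trans (e j i) (cong (_+_ (A j i)) (ℤP.*-comm (A j (src i)) (coef i)))))

      rowPermute : ∀ {A} (π τ : C → C) → (∀ x → τ (π x) ≡ x) → (∀ x → π (τ x) ≡ x) →
                A ~ (λ i j → A (π i) j)
      rowPermute {A} π τ e1 e2 = ~-left P (Q , pq , qp) (λ i j → S-δ (π i) (λ k → A k j))
        where P Q : Mt
              P i k = ind (eqb (π i) k)
              Q i k = ind (eqb (τ i) k)
              pq : (P ⊛ Q) ≑ 𝕀
              pq i j = trans (S-δ (π i) (λ k → Q k j)) (cong (λ x → ind (eqb x j)) (e1 i))
              qp : (Q ⊛ P) ≑ 𝕀
              qp i j = trans (S-δ (τ i) (λ k → P k j)) (cong (λ x → ind (eqb x j)) (e2 i))

      colPermute : ∀ {A} (π τ : C → C) → (∀ x → τ (π x) ≡ x) → (∀ x → π (τ x) ≡ x) →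
                A ~ (λ i j → A i (π j))
      colPermute {A} π τ e1 e2 = ~-ᵀ (rowPermute {ᵀ A} π τ e1 e2)

      rowScale : ∀ {A} (ε : C → ℤ) → (∀ x → ε x * ε x ≡ + 1) → A ~ (λ i j → ε i * A i j)
      rowScale {A} ε e = ~-left P (P , pp , pp) (λ i j → lem A i j)
        where P : Mt
              P i k = ε i * ind (eqb i k)
              lem : ∀ X i j → (P ⊛ X) i j ≡ ε i * X i j
              lem X i j = trans (S-cong (λ k → ℤP.*-assoc (ε i) _ (X k j)))
                (trans (S-* (ε i) _) (cong (ε i *_) (S-δ i (λ k → X k j))))
              pp : (P ⊛ P) ≑ 𝕀
              pp i j = trans (lem P i j) (trans (sym (ℤP.*-assoc (ε i) (ε i) _)) (trans (cong (_* ind (eqb i j)) (e i)) (ℤP.*-identityˡ _)))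

      module TwoRows (i1 i2 : C) (ne : eqb i1 i2 ≡ false) where
        sel : ∀ {ℓ} {T : Set ℓ} → Bool → Bool → T → T → T → T
        sel true  _     x y z = x
        sel false true  x y z = y
        sel false false x y z = z

        R : ℤ → ℤ → ℤ → ℤ → Mt
        R α β γ δ r k = sel (eqb r i1) (eqb r i2)
          (α * ind (eqb i1 k) + β * ind (eqb i2 k))
          (γ * ind (eqb i1 k) + δ * ind (eqb i2 k)) (𝕀 r k)

        mixRows : ℤ → ℤ → ℤ → ℤ → Mt → Mt
        mixRows α β γ δ X r c = sel (eqb r i1) (eqb r i2)
          (α * X i1 c + β * X i2 c) (γ * X i1 c + δ * X i2 c) (X r c)

        S-twoPoints : ∀ α β (f : C → ℤ) → S (λ k → (α * ind (eqb i1 k) + β * ind (eqb i2 k)) * f k) ≡ α * f i1 + β * f i2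
        S-twoPoints α β f = trans (S-cong (λ k → lem α β (ind (eqb i1 k)) (ind (eqb i2 k)) (f k)))
          (trans (S-+ _ _) (cong₂ _+_ (trans (S-* α _) (cong (α *_) (S-δ i1 f)))
                                       (trans (S-* β _) (cong (β *_) (S-δ i2 f)))))
          where lem : ∀ a b x y z → (a * x + b * y) * z ≡ a * (x * z) + b * (y * z)
                lem = solve-∀

        R-⊛ : ∀ α β γ δ X r c → (R α β γ δ ⊛ X) r c ≡ mixRows α β γ δ X r c
        R-⊛ α β γ δ X r c with eqb r i1 | eqb r i2
        ... | true | _ = S-twoPoints α β (λ k → X k c)
        ... | false | true = S-twoPoints γ δ (λ k → X k c)
        ... | false | false = S-δ r (λ k → X k c)

        ne' : eqb i2 i1 ≡ false
        ne' = trans (eqb-sym i2 i1) ne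

        R-row1 : ∀ α β γ δ c → R α β γ δ i1 c ≡ α * ind (eqb i1 c) + β * ind (eqb i2 c)
        R-row1 α β γ δ c = cong (λ b → sel b (eqb i1 i2) (α * ind (eqb i1 c) + β * ind (eqb i2 c))
          (γ * ind (eqb i1 c) + δ * ind (eqb i2 c)) (𝕀 i1 c)) (eqb-refl i1)

        R-row2 : ∀ α β γ δ c → R α β γ δ i2 c ≡ γ * ind (eqb i1 c) + δ * ind (eqb i2 c)
        R-row2 α β γ δ c = cong₂ (λ b b' → sel b b' (α * ind (eqb i1 c) + β * ind (eqb i2 c))
          (γ * ind (eqb i1 c) + δ * ind (eqb i2 c)) (𝕀 i2 c)) ne' (eqb-refl i2)

        bilinear : ∀ a b a' b' c' d' x y → a * (a' * x + b' * y) + b * (c' * x + d' * y) ≡ (a * a' + b * c') * x + (a * b' + b * d') * y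
        bilinear = solve-∀

        R-inverse : ∀ α β γ δ α' β' γ' δ' →
             α * α' + β * γ' ≡ + 1 → α * β' + β * δ' ≡ + 0 →
             γ * α' + δ * γ' ≡ + 0 → γ * β' + δ * δ' ≡ + 1 →
             (R α β γ δ ⊛ R α' β' γ' δ') ≑ 𝕀
        R-inverse α β γ δ α' β' γ' δ' h1 h2 h3 h4 r c =
          trans (R-⊛ α β γ δ R' r c)
            (go (eqb r i1) (eqb r i2) refl refl)
          where
            R' = R α' β' γ' δ'
            X1 = α * R' i1 c + β * R' i2 c
            X2 = γ * R' i1 c + δ * R' i2 c
            x = ind (eqb i1 c)
            y = ind (eqb i2 c)
            e1' : X1 ≡ x
            e1' = trans (cong₂ (λ u v → α * u + β * v) (R-row1 α' β' γ' δ' c) (R-row2 α' β' γ' δ' c))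
                    (trans (bilinear α β α' β' γ' δ' x y)
                      (trans (cong₂ (λ u v → u * x + v * y) h1 h2) (trans (cong₂ _+_ (ℤP.*-identityˡ x) (ℤP.*-zeroˡ y)) (ℤP.+-identityʳ x))))
            e2' : X2 ≡ y
            e2' = trans (cong₂ (λ u v → γ * u + δ * v) (R-row1 α' β' γ' δ' c) (R-row2 α' β' γ' δ' c))
                    (trans (bilinear γ δ α' β' γ' δ' x y)
                      (trans (cong₂ (λ u v → u * x + v * y) h3 h4) (trans (cong₂ _+_ (ℤP.*-zeroˡ x) (ℤP.*-identityˡ y)) (ℤP.+-identityˡ y))))
            go : ∀ b b' → eqb r i1 ≡ b → eqb r i2 ≡ b' → sel b b' X1 X2 (R' r c) ≡ 𝕀 r c
            go true _ e _ = trans e1' (cong (λ z → ind (eqb z c)) (sym (eqb-sound r i1 e)))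
            go false true _ e = trans e2' (cong (λ z → ind (eqb z c)) (sym (eqb-sound r i2 e)))
            go false false e e' = cong₂ (λ b b' → sel b b' (α' * ind (eqb i1 c) + β' * ind (eqb i2 c))
                                          (γ' * ind (eqb i1 c) + δ' * ind (eqb i2 c)) (𝕀 r c)) e e'

        rowMix : ∀ {A} α β γ δ → α * δ - β * γ ≡ + 1 → A ~ mixRows α β γ δ A
        rowMix {A} α β γ δ det = ~-left (R α β γ δ)
          (R δ (- β) (- γ) α ,
           R-inverse α β γ δ δ (- β) (- γ) α (trans (l1 α β γ δ) det) (l2 α β) (l3 γ δ) (trans (l4 α β γ δ) det) ,
           R-inverse δ (- β) (- γ) α α β γ δ (trans (l5 α β γ δ) det) (l6 β δ) (l7 α γ) (trans (l8 α β γ δ) det))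
          (R-⊛ α β γ δ A)
          where l1 : ∀ a b c d → a * d + b * (- c) ≡ a * d - b * c
                l1 = solve-∀
                l2 : ∀ a b → a * (- b) + b * a ≡ + 0
                l2 = solve-∀
                l3 : ∀ c d → c * d + d * (- c) ≡ + 0
                l3 = solve-∀
                l4 : ∀ a b c d → c * (- b) + d * a ≡ a * d - b * c
                l4 = solve-∀
                l5 : ∀ a b c d → d * a + (- b) * c ≡ a * d - b * c
                l5 = solve-∀
                l6 : ∀ b d → d * b + (- b) * d ≡ + 0
                l6 = solve-∀
                l7 : ∀ a c → (- c) * a + a * c ≡ + 0
                l7 = solve-∀
                l8 : ∀ a b c d → (- c) * b + a * d ≡ a * d - b * c
                l8 = solve-∀

        colMix : ∀ {A} α β γ δ → α * δ - β * γ ≡ + 1 → A ~ ᵀ (mixRows α β γ δ (ᵀ A))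
        colMix {A} α β γ δ det = ~-ᵀ (rowMix {ᵀ A} α β γ δ det)

    δ-refl : ∀ {n} (x : Fin n) → δ x x ≡ true
    δ-refl zero = refl
    δ-refl (suc x) = δ-refl x

    δ-sound : ∀ {n} (x y : Fin n) → δ x y ≡ true → x ≡ y
    δ-sound zero zero e = refl
    δ-sound zero (suc y) ()
    δ-sound (suc x) zero ()
    δ-sound (suc x) (suc y) e = cong suc (δ-sound x y e)

    finIndex : ℕ → FiniteIndex
    finIndex n = record
      { C = Fin n ; S = Σℤ ; eqb = δ ; S-cong = Σ-cong ; S-+ = Σ-+ ; S-* = Σ-* ; S-swap = Σ-swap
      ; S-δ = Σ-δ ; S-δ' = Σ-δ' ; eqb-refl = δ-refl ; eqb-sound = δ-sound }

    ind-∧ : ∀ x y → ind (x ∧ y) ≡ ind x * ind y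
    ind-∧ true true = refl
    ind-∧ true false = refl
    ind-∧ false y = sym (ℤP.*-zeroˡ (ind y))

    module _ {a b : ℕ} where
      ΣP : (Fin a × Fin b → ℤ) → ℤ
      ΣP f = Σℤ (λ q → Σℤ (λ l → f (q , l)))

      eqbP : Fin a × Fin b → Fin a × Fin b → Bool
      eqbP (p , k) (q , l) = δ p q ∧ δ k l

      pairIndex : FiniteIndex
      pairIndex = record
        { C = Fin a × Fin b ; S = ΣP ; eqb = eqbP
        ; S-cong = λ h → Σ-cong (λ q → Σ-cong (λ l → h (q , l)))
        ; S-+ = λ f g → trans (Σ-cong (λ q → Σ-+ {b} (λ l → f (q , l)) (λ l → g (q , l)))) (Σ-+ {a} (λ q → Σℤ (λ l → f (q , l))) (λ q → Σℤ (λ l → g (q , l))))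
        ; S-* = λ c f → trans (Σ-cong (λ q → Σ-* {b} c (λ l → f (q , l)))) (Σ-* {a} c (λ q → Σℤ (λ l → f (q , l))))
        ; S-swap = ΣP-swap
        ; S-δ = ΣP-δ
        ; S-δ' = ΣP-δ'
        ; eqb-refl = λ { (p , k) → cong₂ _∧_ (δ-refl p) (δ-refl k) }
        ; eqb-sound = eqbP-sound }
        where
          ΣP-swap : ∀ (f : Fin a × Fin b → Fin a × Fin b → ℤ) → ΣP (λ i → ΣP (λ j → f i j)) ≡ ΣP (λ j → ΣP (λ i → f i j))
          ΣP-swap f = trans (Σ-cong (λ q → Σ-swap (λ l q' → Σℤ (λ l' → f (q , l) (q' , l')))))
                 (trans (Σ-swap (λ q q' → Σℤ (λ l → Σℤ (λ l' → f (q , l) (q' , l')))))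
                 (Σ-cong (λ q' → trans (Σ-cong (λ q → Σ-swap (λ l l' → f (q , l) (q' , l'))))
                                       (Σ-swap (λ q l' → Σℤ (λ l → f (q , l) (q' , l')))))))
          ΣP-δ : ∀ i (f : Fin a × Fin b → ℤ) → ΣP (λ k → ind (eqbP i k) * f k) ≡ f i
          ΣP-δ (p , k) f = trans (Σ-cong (λ q → trans (Σ-cong (λ l → trans (cong (_* f (q , l)) (ind-∧ (δ p q) (δ k l)))
                                                                  (ℤP.*-assoc (ind (δ p q)) _ _)))
                                                 (Σ-* {b} (ind (δ p q)) (λ l → ind (δ k l) * f (q , l)))))
                          (trans (Σ-δ p (λ q → Σℤ (λ l → ind (δ k l) * f (q , l)))) (Σ-δ k (λ l → f (p , l))))
          ΣP-δ' : ∀ i (f : Fin a × Fin b → ℤ) → ΣP (λ k → f k * ind (eqbP k i)) ≡ f i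
          ΣP-δ' (p , k) f = trans (Σ-cong (λ q → trans (Σ-cong (λ l → trans (cong (f (q , l) *_) (ind-∧ (δ q p) (δ l k)))
                                                                  (lem (f (q , l)) (ind (δ q p)) (ind (δ l k)))))
                                                 (Σ-*ʳ {b} (ind (δ q p)) (λ l → f (q , l) * ind (δ l k)))))
                          (trans (Σ-δ' p (λ q → Σℤ (λ l → f (q , l) * ind (δ l k)))) (Σ-δ' k (λ l → f (p , l))))
            where lem : ∀ x y z → x * (y * z) ≡ x * z * y
                  lem = solve-∀
          eqbP-sound : ∀ x y → eqbP x y ≡ true → x ≡ y
          eqbP-sound (p , k) (q , l) e with δ p q in e1 | δ k l in e2
          eqbP-sound (p , k) (q , l) refl | true | true = cong₂ _,_ (δ-sound p q e1) (δ-sound k l e2)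

  module Flattening where

    open Equivalence

    Σ-split : ∀ a {b} (f : Fin (a ℕ.+ b) → ℤ) → Σℤ f ≡ Σℤ (λ i → f (i ↑ˡ b)) + Σℤ (λ j → f (a ↑ʳ j))
    Σ-split zero f = sym (ℤP.+-identityˡ _)
    Σ-split (suc a) {b} f rewrite Σ-split a (λ k → f (suc k)) = sym (ℤP.+-assoc (f zero) _ _)

    Σ-combine : ∀ m s (f : Fin (m ℕ.* s) → ℤ) → Σℤ f ≡ Σℤ {m} (λ q → Σℤ {s} (λ l → f (combine q l)))
    Σ-combine zero s f = refl
    Σ-combine (suc m) s f = trans (Σ-split s f) (cong (_+_ (Σℤ (λ i → f (i ↑ˡ (m ℕ.* s))))) (Σ-combine m s (λ k → f (s ↑ʳ k))))

    Σ-γ : ∀ m s (h : Fin m × Fin s → ℤ) → Σℤ (λ k → h (remQuot {m} s k)) ≡ ΣP h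
    Σ-γ m s h = trans (Σ-combine m s _) (Σ-cong (λ q → Σ-cong (λ l → cong h (remQuot-combine q l))))

    bool-ext : ∀ {x y : Bool} → (x ≡ true → y ≡ true) → (y ≡ true → x ≡ true) → x ≡ y
    bool-ext {true} {true} f g = refl
    bool-ext {true} {false} f g = sym (f refl)
    bool-ext {false} {true} f g = g refl
    bool-ext {false} {false} f g = refl

    δ-γ : ∀ m s (i j : Fin (m ℕ.* s)) → δ i j ≡ eqbP (remQuot {m} s i) (remQuot {m} s j)
    δ-γ m s i j = bool-ext
      (λ e → subst (λ z → eqbP (remQuot {m} s i) (remQuot {m} s z) ≡ true) (δ-sound i j e) (FiniteIndex.eqb-refl pairIndex (remQuot {m} s i)))
      (λ e → subst (λ z → δ i z ≡ true)
         (trans (sym (combine-remQuot {m} s i)) (trans (cong (uncurry (combine {m} {s})) (FiniteIndex.eqb-sound (pairIndex {m} {s}) (remQuot {m} s i) (remQuot {m} s j) e)) (combine-remQuot {m} s j)))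
         (δ-refl i))

    module Flatten (m s : ℕ) where
      module F = Matrices (finIndex (m ℕ.* s))
      module P = Matrices (pairIndex {m} {s})

      γ : Fin (m ℕ.* s) → Fin m × Fin s
      γ = remQuot {m} s

      flatten : P.Mt → F.Mt
      flatten A i j = A (γ i) (γ j)

      flatten-⊛ : ∀ A B → flatten (A P.⊛ B) F.≑ (flatten A F.⊛ flatten B)
      flatten-⊛ A B i j = sym (Σ-γ m s (λ k → A (γ i) k * B k (γ j)))

      flatten-𝕀 : flatten P.𝕀 F.≑ F.𝕀
      flatten-𝕀 i j = cong ind (sym (δ-γ m s i j))

      flatten-unimod : ∀ {A} → P.Unimod A → F.Unimod (flatten A)
      flatten-unimod {A} (Q , e1 , e2) = flatten Q ,
        (λ i j → trans (sym (flatten-⊛ A Q i j)) (trans (e1 (γ i) (γ j)) (flatten-𝕀 i j))) ,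
        (λ i j → trans (sym (flatten-⊛ Q A i j)) (trans (e2 (γ i) (γ j)) (flatten-𝕀 i j)))

      flatten-~ : ∀ {A B} → A P.~ B → flatten A F.~ flatten B
      flatten-~ {A} {B} (Pm , Q , uP , uQ , e) = flatten Pm , flatten Q , flatten-unimod uP , flatten-unimod uQ ,
        λ i j → trans (sym (trans (flatten-⊛ (Pm P.⊛ A) Q i j) (F.⊛-congˡ (flatten Q) (flatten-⊛ Pm A) i j))) (e (γ i) (γ j))

  module Reduction where

    open Equivalence

    E : ∀ {n} → Fin n → Fin n → ℤ
    E p q = ind (δ p q)

    NE : ∀ {n} → Fin n → Fin n → ℤ
    NE p q = + 1 - E p q

    Σ-≡0 : ∀ {n} {f : Fin n → ℤ} → (∀ k → f k ≡ + 0) → Σℤ f ≡ + 0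
    Σ-≡0 {n} h = trans (Σ-cong h) (Σ-0 {n})

    Σ-≡const : ∀ {n} {f : Fin n → ℤ} (c : ℤ) → (∀ k → f k ≡ c) → Σℤ f ≡ + n * c
    Σ-≡const {n} c h = trans (Σ-cong h) (Σ-const {n} c)

    Σ*0 : ∀ {n} (f : Fin n → ℤ) → Σℤ (λ k → f k * + 0) ≡ + 0
    Σ*0 f = Σ-≡0 (λ k → ℤP.*-zeroʳ (f k))

    Σ-lin : ∀ {n} (p : Fin n) (α β : ℤ) → Σℤ (λ q → α * E p q + β) ≡ α + + n * β
    Σ-lin {n} p α β = trans (Σ-+ (λ q → α * E p q) (λ _ → β))
      (cong₂ _+_ (trans (Σ-cong (λ q → ℤP.*-comm α (E p q))) (Σ-δ p (λ _ → α))) (Σ-const {n} β))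

    replaceSummand : ∀ {a y} b → a ≡ b + y → ∀ {x} → x ≡ y → a ≡ b + x
    replaceSummand b h refl = h

    -- Index (p , k) is vertex k of part p; writing m = m2 + 2 and s = s2 + 2 lets the
    -- first two parts and the first two vertices of each part be split off by pattern matching.
    module Blocks (m2 s2 : ℕ) where
      M Sn : ℕ
      M = suc (suc m2)
      Sn = suc (suc s2)
      open Matrices (pairIndex {M} {Sn}) public
      open FiniteIndex (pairIndex {M} {Sn}) using (C) public

      blockDiag : (Fin Sn → Fin Sn → ℤ) → Mt
      blockDiag n (p , k) (q , l) = E p q * n k l

      blockDiag-⊛ : ∀ n X p k c → (blockDiag n ⊛ X) (p , k) c ≡ Σℤ (λ l → n k l * X (p , l) c)
      blockDiag-⊛ n X p k c =
        trans (Σ-cong (λ q → trans (Σ-cong (λ l → ℤP.*-assoc (E p q) (n k l) (X (q , l) c)))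
                                    (Σ-* (E p q) (λ l → n k l * X (q , l) c))))
              (Σ-δ p (λ q → Σℤ (λ l → n k l * X (q , l) c)))

      ⊛-blockDiag : ∀ n X r q l → (X ⊛ blockDiag n) r (q , l) ≡ Σℤ (λ k → X r (q , k) * n k l)
      ⊛-blockDiag n X r q l =
        trans (Σ-cong (λ p → trans (Σ-cong (λ k → lem (X r (p , k)) (E p q) (n k l)))
                                    (Σ-*ʳ (E p q) (λ k → X r (p , k) * n k l))))
              (Σ-δ' q (λ p → Σℤ (λ k → X r (p , k) * n k l)))
        where lem : ∀ a b c → a * (b * c) ≡ a * c * b
              lem = solve-∀

      rowsFromSlot : Fin Sn → (Fin M → Fin Sn → Fin M → ℤ) → Mt
      rowsFromSlot l1 n (p , k) (q , l) = n p k q * E l1 l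

      rowsFromSlot-⊛ : ∀ l1 n X r c → (rowsFromSlot l1 n ⊛ X) r c ≡ Σℤ (λ q → n (proj₁ r) (proj₂ r) q * X (q , l1) c)
      rowsFromSlot-⊛ l1 n X (p , k) c = Σ-cong (λ q →
        trans (Σ-cong (λ l → trans (ℤP.*-assoc (n p k q) (E l1 l) (X (q , l) c)) (cong (n p k q *_) (ℤP.*-comm (E l1 l) (X (q , l) c)))))
         (trans (Σ-* (n p k q) (λ l → X (q , l) c * E l1 l)) (cong (n p k q *_) (Σ-δ'' l1 (λ l → X (q , l) c)))))
        where Σ-δ'' : ∀ {n} (i : Fin n) (f : Fin n → ℤ) → Σℤ (λ k → f k * ind (δ i k)) ≡ f i
              Σ-δ'' i f = trans (Σ-cong (λ k → ℤP.*-comm (f k) _)) (Σ-δ i f)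

      colsFromSlot : Fin Sn → (Fin M → C → ℤ) → Mt
      colsFromSlot k1 n (p , k) c = E k1 k * n p c

      ⊛-colsFromSlot : ∀ k1 n X r c → (X ⊛ colsFromSlot k1 n) r c ≡ Σℤ (λ p → X r (p , k1) * n p c)
      ⊛-colsFromSlot k1 n X r c = Σ-cong (λ p →
        trans (Σ-cong (λ k → lem (X r (p , k)) (E k1 k) (n p c)))
         (trans (Σ-*ʳ (n p c) (λ k → E k1 k * X r (p , k))) (cong (_* n p c) (Σ-δ k1 (λ k → X r (p , k))))))
        where lem : ∀ a b c → a * (b * c) ≡ b * a * c
              lem = solve-∀

      module Chain (t : ℤ) where
        s : ℤ
        s = + 2 + + s2

        A0 : Mt
        A0 (p , k) (q , l) = t * (E p q * E k l) - NE p q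

        -- col (q , l+1) −= col (q , 0)
        A1 : Mt
        A1 r (q , zero) = A0 r (q , zero)
        A1 (p , k) (q , suc l) = t * (E p q * E k (suc l)) - t * (E p q * E k zero)

        A0~A1 : A0 ~ A1
        A0~A1 = colAdd {A0} src coef (λ r → ℤP.*-zeroʳ (coef r)) A1 e
          where
            src : C → C
            src (q , l) = (q , zero)
            coef : C → ℤ
            coef (q , zero) = + 0
            coef (q , suc l) = - + 1
            lem : ∀ t e a b n → t * (e * a) - t * (e * b) ≡ (t * (e * a) - n) + (t * (e * b) - n) * (- + 1)
            lem = solve-∀
            e : ∀ i j → A1 i j ≡ A0 i j + A0 i (src j) * coef j
            e i (q , zero) = sym (trans (cong (_+_ (A0 i (q , zero))) (ℤP.*-zeroʳ (A0 i (q , zero)))) (ℤP.+-identityʳ _))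
            e (p , k) (q , suc l) = lem t (E p q) (E k (suc l)) (E k zero) (NE p q)

        -- row (p , 0) += Σₖ row (p , k+1)
        n2 : Fin Sn → Fin Sn → ℤ
        n2 k zero = + 0
        n2 zero (suc l) = + 1
        n2 (suc k) (suc l) = + 0

        A2 : Mt
        A2 (p , zero) (q , zero) = t * E p q - s * NE p q
        A2 (p , zero) (q , suc l) = + 0
        A2 (p , suc k) c = A1 (p , suc k) c

        A1~A2 : A1 ~ A2
        A1~A2 = rowAddNilpotent {A1} (blockDiag n2) N⊛N≑𝟘 A2 e
          where
            N⊛N≑𝟘 : (blockDiag n2 ⊛ blockDiag n2) ≑ 𝟘
            N⊛N≑𝟘 (p , k) (q , l) = trans (blockDiag-⊛ n2 (blockDiag n2) p k (q , l)) (Σ-≡0 (pt l))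
              where pt : ∀ l l' → n2 k l' * (E p q * n2 l' l) ≡ + 0
                    pt l zero = refl
                    pt zero (suc l') = trans (cong (n2 k (suc l') *_) (ℤP.*-zeroʳ (E p q))) (ℤP.*-zeroʳ (n2 k (suc l')))
                    pt (suc l) (suc l') = trans (cong (n2 k (suc l') *_) (ℤP.*-zeroʳ (E p q))) (ℤP.*-zeroʳ (n2 k (suc l')))
            l1 : ∀ t e n S2 → t * e - (+ 2 + S2) * n ≡ (t * (e * + 1) - n) + (+ 0 + (+ 1 + S2) * (- n))
            l1 = solve-∀
            p1 : ∀ t e n → + 1 * (t * (e * + 0) - n) ≡ - n
            p1 = solve-∀
            l2 : ∀ t e → + 0 ≡ (t * (e * + 0) - t * (e * + 1)) + (+ 0 + t * e)
            l2 = solve-∀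
            p2 : ∀ t e x → + 1 * (t * (e * x) - t * (e * + 0)) ≡ t * e * x
            p2 = solve-∀
            e : ∀ i j → A2 i j ≡ A1 i j + (blockDiag n2 ⊛ A1) i j
            e (p , zero) (q , zero) rewrite blockDiag-⊛ n2 A1 p zero (q , zero) =
              trans (l1 t (E p q) (NE p q) (+ s2))
                (cong (λ z → (t * (E p q * + 1) - NE p q) + (+ 0 + z))
                      (sym (Σ-≡const {suc s2} (- NE p q) (λ l' → p1 t (E p q) (NE p q)))))
            e (p , zero) (q , suc l) rewrite blockDiag-⊛ n2 A1 p zero (q , suc l) =
              trans (l2 t (E p q))
                (cong (λ z → (t * (E p q * + 0) - t * (E p q * + 1)) + (+ 0 + z))
                      (sym (trans (Σ-cong (λ l' → p2 t (E p q) (E l' l))) (Σ-δ' l (λ _ → t * E p q)))))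
            e (p , suc k) j rewrite blockDiag-⊛ n2 A1 p (suc k) j =
              sym (trans (cong (_+_ (A1 (p , suc k) j)) (Σ-≡0 {Sn} {λ l → n2 (suc k) l * A1 (p , l) j} λ { zero → refl ; (suc l) → refl })) (ℤP.+-identityʳ _))

        -- row (p , k+2) −= row (p , 1)
        A3 : Mt
        A3 (p , zero) c = A2 (p , zero) c
        A3 (p , suc zero) c = A2 (p , suc zero) c
        A3 (p , suc (suc k)) (q , zero) = + 0
        A3 (p , suc (suc k)) (q , suc zero) = - (t * E p q)
        A3 (p , suc (suc k)) (q , suc (suc l)) = t * E p q * E k l

        A2~A3 : A2 ~ A3
        A2~A3 = rowAdd {A2} src coef (λ r → ℤP.*-zeroʳ (coef r)) A3 e
          where
            src : C → C
            src (p , k) = (p , suc zero)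
            coef : C → ℤ
            coef (p , suc (suc k)) = - + 1
            coef (p , zero) = + 0
            coef (p , suc zero) = + 0
            l1 : ∀ t e n → + 0 ≡ (t * (e * + 0) - n) + (- + 1) * (t * (e * + 0) - n)
            l1 = solve-∀
            l2 : ∀ t e → - (t * e) ≡ (t * (e * + 0) - t * (e * + 0)) + (- + 1) * (t * (e * + 1) - t * (e * + 0))
            l2 = solve-∀
            l3 : ∀ t e x → t * e * x ≡ (t * (e * x) - t * (e * + 0)) + (- + 1) * (t * (e * + 0) - t * (e * + 0))
            l3 = solve-∀
            e : ∀ i j → A3 i j ≡ A2 i j + coef i * A2 (src i) j
            e (p , zero) j = sym (ℤP.+-identityʳ _)
            e (p , suc zero) j = sym (ℤP.+-identityʳ _)
            e (p , suc (suc k)) (q , zero) = l1 t (E p q) (NE p q)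
            e (p , suc (suc k)) (q , suc zero) = l2 t (E p q)
            e (p , suc (suc k)) (q , suc (suc l)) = l3 t (E p q) (E k l)

        -- col (q , 1) += Σₗ col (q , l+2)
        n4 : Fin Sn → Fin Sn → ℤ
        n4 k zero = + 0
        n4 k (suc (suc l)) = + 0
        n4 zero (suc zero) = + 0
        n4 (suc zero) (suc zero) = + 0
        n4 (suc (suc k)) (suc zero) = + 1

        A4 : Mt
        A4 (p , zero) (q , zero) = t * E p q - s * NE p q
        A4 (p , zero) (q , suc l) = + 0
        A4 (p , suc zero) (q , zero) = - NE p q
        A4 (p , suc zero) (q , suc zero) = t * E p q
        A4 (p , suc zero) (q , suc (suc l)) = + 0
        A4 (p , suc (suc k)) (q , zero) = + 0
        A4 (p , suc (suc k)) (q , suc zero) = + 0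
        A4 (p , suc (suc k)) (q , suc (suc l)) = t * E p q * E k l

        A3~A4 : A3 ~ A4
        A3~A4 = colAddNilpotent {A3} N N⊛N≑𝟘 A4 e
          where
            N : Mt
            N = blockDiag n4
            N⊛N≑𝟘 : (N ⊛ N) ≑ 𝟘
            N⊛N≑𝟘 (p , k) (q , l) = trans (blockDiag-⊛ n4 N p k (q , l)) (Σ-≡0 (pt l))
              where pt : ∀ l l' → n4 k l' * (E p q * n4 l' l) ≡ + 0
                    pt l zero = refl
                    pt l (suc (suc l')) = refl
                    pt zero (suc zero) = trans (cong (n4 k (suc zero) *_) (ℤP.*-zeroʳ (E p q))) (ℤP.*-zeroʳ (n4 k (suc zero)))
                    pt (suc zero) (suc zero) = trans (cong (n4 k (suc zero) *_) (ℤP.*-zeroʳ (E p q))) (ℤP.*-zeroʳ (n4 k (suc zero)))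
                    pt (suc (suc l)) (suc zero) = trans (cong (n4 k (suc zero) *_) (ℤP.*-zeroʳ (E p q))) (ℤP.*-zeroʳ (n4 k (suc zero)))
            A3⊛N : ∀ r q l → (A3 ⊛ N) r (q , l) ≡ Σℤ (λ k → A3 r (q , k) * n4 k l)
            A3⊛N r q l = ⊛-blockDiag n4 A3 r q l
            A3⊛N-col0 : ∀ r q → (A3 ⊛ N) r (q , zero) ≡ + 0
            A3⊛N-col0 r q = trans (A3⊛N r q zero) (Σ*0 (λ k → A3 r (q , k)))
            A3⊛N-col2+ : ∀ r q l → (A3 ⊛ N) r (q , suc (suc l)) ≡ + 0
            A3⊛N-col2+ r q l = trans (A3⊛N r q (suc (suc l))) (Σ*0 (λ k → A3 r (q , k)))
            m1 : ∀ a b x → a * + 0 + (b * + 0 + x) ≡ x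
            m1 = solve-∀
            A3⊛N-col1 : ∀ r q → (A3 ⊛ N) r (q , suc zero) ≡ Σℤ (λ k → A3 r (q , suc (suc k)))
            A3⊛N-col1 r q = trans (A3⊛N r q (suc zero)) (trans (m1 (A3 r (q , zero)) (A3 r (q , suc zero)) (Σℤ (λ k → A3 r (q , suc (suc k)) * + 1))) (Σ-cong (λ k → ℤP.*-identityʳ (A3 r (q , suc (suc k))))))
            l10 : ∀ t e n → - n ≡ (t * (e * + 0) - n) + + 0
            l10 = solve-∀
            l11 : ∀ t e → t * e ≡ (t * (e * + 1) - t * (e * + 0)) + + 0
            l11 = solve-∀
            p11 : ∀ t e → t * (e * + 0) - t * (e * + 0) ≡ + 0
            p11 = solve-∀
            l21 : ∀ t e → + 0 ≡ - (t * e) + t * e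
            l21 = solve-∀
            e : ∀ i j → A4 i j ≡ A3 i j + (A3 ⊛ N) i j
            e (p , zero) (q , zero) = trans (sym (ℤP.+-identityʳ (A3 (p , zero) (q , zero)))) (cong (_+_ (A3 (p , zero) (q , zero))) (sym (A3⊛N-col0 (p , zero) q)))
            e (p , zero) (q , suc zero) = trans (sym (Σ-≡0 {s2} {λ k → A3 (p , zero) (q , suc (suc k))} (λ k → refl))) (trans (sym (A3⊛N-col1 (p , zero) q)) (sym (ℤP.+-identityˡ ((A3 ⊛ N) (p , zero) (q , suc zero)))))
            e (p , zero) (q , suc (suc l)) = trans (sym (A3⊛N-col2+ (p , zero) q l)) (sym (ℤP.+-identityˡ ((A3 ⊛ N) (p , zero) (q , suc (suc l)))))
            e (p , suc zero) (q , zero) = trans (l10 t (E p q) (NE p q)) (cong (_+_ (A3 (p , suc zero) (q , zero))) (sym (A3⊛N-col0 (p , suc zero) q)))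
            e (p , suc zero) (q , suc zero) =
              trans (l11 t (E p q)) (cong (_+_ (A3 (p , suc zero) (q , suc zero)))
                 (sym (trans (A3⊛N-col1 (p , suc zero) q) (Σ-≡0 {s2} {λ k → A3 (p , suc zero) (q , suc (suc k))} (λ k → p11 t (E p q))))))
            e (p , suc zero) (q , suc (suc l)) = trans (sym (p11 t (E p q))) (trans (sym (ℤP.+-identityʳ (A3 (p , suc zero) (q , suc (suc l)))))
                 (cong (_+_ (A3 (p , suc zero) (q , suc (suc l)))) (sym (A3⊛N-col2+ (p , suc zero) q l))))
            e (p , suc (suc k)) (q , zero) = trans (sym (A3⊛N-col0 (p , suc (suc k)) q)) (sym (ℤP.+-identityˡ ((A3 ⊛ N) (p , suc (suc k)) (q , zero))))
            e (p , suc (suc k)) (q , suc zero) =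
              trans (l21 t (E p q)) (cong (_+_ (- (t * E p q)))
                 (sym (trans (A3⊛N-col1 (p , suc (suc k)) q) (trans (Σ-cong {s2} {λ l → t * E p q * E k l} (λ l → ℤP.*-comm (t * E p q) (E k l)))
                                                            (Σ-δ k (λ _ → t * E p q))))))
            e (p , suc (suc k)) (q , suc (suc l)) = trans (sym (ℤP.+-identityʳ (t * E p q * E k l))) (cong (_+_ (t * E p q * E k l)) (sym (A3⊛N-col2+ (p , suc (suc k)) q l)))

        m' : ℤ
        m' = + 1 + + m2

        X : Fin M → Fin M → ℤ
        X p q = t * E p q - s * NE p q

        -- row (p+1 , 1) −= row (0 , 1)
        A5 : Mt
        A5 (p , zero) c = A4 (p , zero) c
        A5 (p , suc (suc k)) c = A4 (p , suc (suc k)) c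
        A5 (zero , suc zero) c = A4 (zero , suc zero) c
        A5 (suc p' , suc zero) (q , suc (suc l)) = + 0
        A5 (suc p' , suc zero) (zero , zero) = - + 1
        A5 (suc p' , suc zero) (suc q' , zero) = E p' q'
        A5 (suc p' , suc zero) (zero , suc zero) = - t
        A5 (suc p' , suc zero) (suc q' , suc zero) = t * E p' q'

        A4~A5 : A4 ~ A5
        A4~A5 = rowAdd {A4} src coef (λ r → ℤP.*-zeroʳ (coef r)) A5 e
          where
            src : C → C
            src _ = (zero , suc zero)
            coef : C → ℤ
            coef (p , zero) = + 0
            coef (p , suc (suc k)) = + 0
            coef (zero , suc zero) = + 0
            coef (suc p' , suc zero) = - + 1
            l1 : - + 1 ≡ - (+ 1 - + 0) + (- + 1) * (- (+ 1 - + 1))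
            l1 = refl
            l2 : ∀ e → e ≡ - (+ 1 - e) + (- + 1) * (- (+ 1 - + 0))
            l2 = solve-∀
            l3 : ∀ t → - t ≡ t * + 0 + (- + 1) * (t * + 1)
            l3 = solve-∀
            l4 : ∀ t e → t * e ≡ t * e + (- + 1) * (t * + 0)
            l4 = solve-∀
            e : ∀ i j → A5 i j ≡ A4 i j + coef i * A4 (src i) j
            e (p , zero) j = sym (ℤP.+-identityʳ _)
            e (zero , suc zero) j = sym (ℤP.+-identityʳ _)
            e (p , suc (suc k)) j = sym (ℤP.+-identityʳ _)
            e (suc p' , suc zero) (zero , zero) = l1
            e (suc p' , suc zero) (suc q' , zero) = l2 (E p' q')
            e (suc p' , suc zero) (zero , suc zero) = l3 t
            e (suc p' , suc zero) (suc q' , suc zero) = l4 t (E p' q')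
            e (suc p' , suc zero) (q , suc (suc l)) = refl

        -- row (p , 0) −= Σ_q X p (q+1) · row (q+1 , 1);  row (0 , 1) += Σ_q row (q+1 , 1)
        n6 : Fin M → Fin Sn → Fin M → ℤ
        n6 p k zero = + 0
        n6 p zero (suc q') = - X p (suc q')
        n6 p (suc (suc k)) (suc q') = + 0
        n6 zero (suc zero) (suc q') = + 1
        n6 (suc p') (suc zero) (suc q') = + 0

        A6 : Mt
        A6 (p , suc (suc k)) c = A5 (p , suc (suc k)) c
        A6 (suc p' , suc zero) c = A5 (suc p' , suc zero) c
        A6 (zero , suc zero) (q , suc (suc l)) = + 0
        A6 (zero , suc zero) (zero , zero) = - m'
        A6 (zero , suc zero) (suc q' , zero) = + 0
        A6 (zero , suc zero) (zero , suc zero) = t - m' * t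
        A6 (zero , suc zero) (suc q' , suc zero) = t
        A6 (p , zero) (q , suc (suc l)) = + 0
        A6 (p , zero) (zero , zero) = t - s * m'
        A6 (p , zero) (suc q' , zero) = + 0
        A6 (p , zero) (suc q' , suc zero) = - (X p (suc q') * t)
        A6 (zero , zero) (zero , suc zero) = - (t * (s * m'))
        A6 (suc p' , zero) (zero , suc zero) = t * (t - s * + m2)

        A5~A6 : A5 ~ A6
        A5~A6 = rowAddNilpotent {A5} N N⊛N≑𝟘 A6 e
          where
            N : Mt
            N = rowsFromSlot (suc zero) n6
            N⊛N≑𝟘 : (N ⊛ N) ≑ 𝟘
            N⊛N≑𝟘 (p , k) (q2 , l2) = trans (rowsFromSlot-⊛ (suc zero) n6 N (p , k) (q2 , l2)) (Σ-≡0 (pt q2))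
              where pt : ∀ q2 q → n6 p k q * N (q , suc zero) (q2 , l2) ≡ + 0
                    pt q2 zero = refl
                    pt zero (suc q) = ℤP.*-zeroʳ (n6 p k (suc q))
                    pt (suc q2) (suc q) = ℤP.*-zeroʳ (n6 p k (suc q))
            N⊛A5 : ∀ p k c → (N ⊛ A5) (p , k) c ≡ Σℤ (λ q' → n6 p k (suc q') * A5 (suc q' , suc zero) c)
            N⊛A5 p k c = trans (rowsFromSlot-⊛ (suc zero) n6 A5 (p , k) c) (ℤP.+-identityˡ _)
            unchanged : ∀ p k c → (∀ q' → n6 p k (suc q') * A5 (suc q' , suc zero) c ≡ + 0) → A6 (p , k) c ≡ A5 (p , k) c →
                 A6 (p , k) c ≡ A5 (p , k) c + (N ⊛ A5) (p , k) c
            unchanged p k c h h' = replaceSummand (A5 (p , k) c) (trans h' (sym (ℤP.+-identityʳ _))) (trans (N⊛A5 p k c) (Σ-≡0 h))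
            la : ∀ m2 → - (+ 1 + m2) ≡ - (+ 1 - + 1) + (+ 1 + m2) * (- + 1)
            la = solve-∀
            lb : + 0 ≡ - (+ 1 - + 0) + + 1
            lb = refl
            lc : ∀ t m2 → t - (+ 1 + m2) * t ≡ t * + 1 + (+ 1 + m2) * (- t)
            lc = solve-∀
            ld : ∀ t → t ≡ t * + 0 + t
            ld = solve-∀
            pa : ∀ (a : ℤ) → + 1 * a ≡ a
            pa = ℤP.*-identityˡ
            le : ∀ t s m2 → t - s * (+ 1 + m2) ≡ (t * + 1 - s * (+ 1 - + 1)) + (+ 1 + m2) * (- s)
            le = solve-∀
            pe : ∀ t s → (- (t * + 0 - s * (+ 1 - + 0))) * (- + 1) ≡ - s
            pe = solve-∀
            lf : ∀ t s m2 → t - s * (+ 1 + m2) ≡ (t * + 0 - s * (+ 1 - + 0)) + ((t + s) + (+ 1 + m2) * (- s))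
            lf = solve-∀
            pf : ∀ t s e → (- (t * e - s * (+ 1 - e))) * (- + 1) ≡ (t + s) * e + (- s)
            pf = solve-∀
            lg : ∀ x → + 0 ≡ x + (- x)
            lg = solve-∀
            lh : ∀ t s m2 → - (t * (s * (+ 1 + m2))) ≡ + 0 + (+ 1 + m2) * (- (t * s))
            lh = solve-∀
            ph : ∀ t s → (- (t * + 0 - s * (+ 1 - + 0))) * (- t) ≡ - (t * s)
            ph = solve-∀
            li : ∀ t s m2 → t * (t - s * m2) ≡ + 0 + (t * (t + s) + (+ 1 + m2) * (- (t * s)))
            li = solve-∀
            pi : ∀ t s e → (- (t * e - s * (+ 1 - e))) * (- t) ≡ t * (t + s) * e + (- (t * s))
            pi = solve-∀
            lj : ∀ x t → - (x * t) ≡ + 0 + (- x * t)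
            lj = solve-∀
            pj : ∀ x t e → (- x) * (t * e) ≡ (- x * t) * e
            pj = solve-∀
            e : ∀ i j → A6 i j ≡ A5 i j + (N ⊛ A5) i j
            e (p , suc (suc k)) c = unchanged p (suc (suc k)) c (λ q' → refl) refl
            e (suc p' , suc zero) c = unchanged (suc p') (suc zero) c (λ q' → refl) refl
            e (zero , suc zero) (q , suc (suc l)) = unchanged zero (suc zero) (q , suc (suc l)) (λ q' → refl) refl
            e (zero , suc zero) (zero , zero) = replaceSummand (A5 (zero , suc zero) (zero , zero)) (la (+ m2)) (trans (N⊛A5 zero (suc zero) (zero , zero)) (Σ-≡const {suc m2} (- + 1) (λ q' → refl)))
            e (zero , suc zero) (suc q' , zero) = replaceSummand (A5 (zero , suc zero) (suc q' , zero)) lb (trans (N⊛A5 zero (suc zero) (suc q' , zero))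
                                                     (trans (Σ-cong (λ q'' → trans (pa (E q'' q')) (sym (ℤP.*-identityˡ (E q'' q'))))) (Σ-δ' q' (λ _ → + 1))))
            e (zero , suc zero) (zero , suc zero) = replaceSummand (A5 (zero , suc zero) (zero , suc zero)) (lc t (+ m2)) (trans (N⊛A5 zero (suc zero) (zero , suc zero)) (Σ-≡const {suc m2} (- t) (λ q' → pa (- t))))
            e (zero , suc zero) (suc q' , suc zero) = replaceSummand (A5 (zero , suc zero) (suc q' , suc zero)) (ld t) (trans (N⊛A5 zero (suc zero) (suc q' , suc zero))
                                                     (trans (Σ-cong (λ q'' → pa (t * E q'' q'))) (Σ-δ' q' (λ _ → t))))
            e (p , zero) (q , suc (suc l)) = unchanged p zero (q , suc (suc l)) (λ q' → ℤP.*-zeroʳ (n6 p zero (suc q'))) refl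
            e (zero , zero) (zero , zero) = replaceSummand (A5 (zero , zero) (zero , zero)) (le t s (+ m2)) (trans (N⊛A5 zero zero (zero , zero)) (Σ-≡const {suc m2} (- s) (λ q' → pe t s)))
            e (suc p' , zero) (zero , zero) = replaceSummand (A5 (suc p' , zero) (zero , zero)) (lf t s (+ m2)) (trans (N⊛A5 (suc p') zero (zero , zero))
                                                  (trans (Σ-cong (λ q' → pf t s (E p' q'))) (Σ-lin p' (t + s) (- s))))
            e (p , zero) (suc q' , zero) = replaceSummand (A5 (p , zero) (suc q' , zero)) (lg (X p (suc q'))) (trans (N⊛A5 p zero (suc q' , zero))
                                             (Σ-δ' q' (λ q'' → - X p (suc q''))))
            e (zero , zero) (zero , suc zero) = replaceSummand (A5 (zero , zero) (zero , suc zero)) (lh t s (+ m2)) (trans (N⊛A5 zero zero (zero , suc zero)) (Σ-≡const {suc m2} (- (t * s)) (λ q' → ph t s)))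
            e (suc p' , zero) (zero , suc zero) = replaceSummand (A5 (suc p' , zero) (zero , suc zero)) (li t s (+ m2)) (trans (N⊛A5 (suc p') zero (zero , suc zero))
                                                  (trans (Σ-cong (λ q' → pi t s (E p' q'))) (Σ-lin p' (t * (t + s)) (- (t * s)))))
            e (p , zero) (suc q' , suc zero) = replaceSummand (A5 (p , zero) (suc q' , suc zero)) (lj (X p (suc q')) t) (trans (N⊛A5 p zero (suc q' , suc zero))
                                             (trans (Σ-cong (λ q'' → pj (X p (suc q'')) t (E q'' q')))
                                                    (Σ-δ' q' (λ q'' → - X p (suc q'') * t))))

        -- col (0 , 0) += Σ_p col (p+1 , 0);  col (0 , 1) += t Σ_p col (p+1 , 0);  col (q+1 , 1) −= t · col (q+1 , 0)
        n7 : Fin M → C → ℤ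
        n7 zero c = + 0
        n7 (suc p') (q , suc (suc l)) = + 0
        n7 (suc p') (zero , zero) = + 1
        n7 (suc p') (suc q' , zero) = + 0
        n7 (suc p') (zero , suc zero) = t
        n7 (suc p') (suc q' , suc zero) = - (t * E p' q')

        A7 : Mt
        A7 (p , zero) c = A6 (p , zero) c
        A7 (p , suc (suc k)) c = A6 (p , suc (suc k)) c
        A7 (zero , suc zero) c = A6 (zero , suc zero) c
        A7 (suc p' , suc zero) (q , suc (suc l)) = + 0
        A7 (suc p' , suc zero) (zero , zero) = + 0
        A7 (suc p' , suc zero) (suc q' , zero) = E p' q'
        A7 (suc p' , suc zero) (zero , suc zero) = + 0
        A7 (suc p' , suc zero) (suc q' , suc zero) = + 0

        A6~A7 : A6 ~ A7
        A6~A7 = colAddNilpotent {A6} N N⊛N≑𝟘 A7 e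
          where
            N : Mt
            N = colsFromSlot zero n7
            N⊛N≑𝟘 : (N ⊛ N) ≑ 𝟘
            N⊛N≑𝟘 r c = trans (⊛-colsFromSlot zero n7 N r c) (Σ-≡0 (pt r))
              where pt : ∀ r p → N r (p , zero) * n7 p c ≡ + 0
                    pt r zero = ℤP.*-zeroʳ (N r (zero , zero))
                    pt (zero , k) (suc p) = cong (_* n7 (suc p) c) (ℤP.*-zeroʳ (E zero k))
                    pt (suc p' , k) (suc p) = cong (_* n7 (suc p) c) (ℤP.*-zeroʳ (E zero k))
            A6⊛N : ∀ r c → (A6 ⊛ N) r c ≡ Σℤ (λ p → A6 r (p , zero) * n7 p c)
            A6⊛N r c = ⊛-colsFromSlot zero n7 A6 r c
            unchanged : ∀ r c → (∀ p' → A6 r (suc p' , zero) * n7 (suc p') c ≡ + 0) → A7 r c ≡ A6 r c →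
                   A7 r c ≡ A6 r c + (A6 ⊛ N) r c
            unchanged r c h h' = trans h' (sym (trans (cong (_+_ (A6 r c)) (trans (A6⊛N r c)
                              (Σ-≡0 {M} {λ p → A6 r (p , zero) * n7 p c} (λ { zero → ℤP.*-zeroʳ (A6 r (zero , zero)) ; (suc p') → h p' })))) (ℤP.+-identityʳ (A6 r c))))
            A6⊛N-row1 : ∀ p' c → (A6 ⊛ N) (suc p' , suc zero) c ≡ n7 (suc p') c
            A6⊛N-row1 p' c = trans (A6⊛N (suc p' , suc zero) c) (trans (ℤP.+-identityˡ _) (Σ-δ p' (λ p'' → n7 (suc p'') c)))
            l1 : ∀ t → + 0 ≡ - t + t
            l1 = solve-∀
            l2 : ∀ t e → + 0 ≡ t * e + - (t * e)
            l2 = solve-∀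
            e : ∀ i j → A7 i j ≡ A6 i j + (A6 ⊛ N) i j
            e (p , zero) c = unchanged (p , zero) c (λ p' → refl) refl
            e (p , suc (suc k)) c = unchanged (p , suc (suc k)) c (λ p' → refl) refl
            e (zero , suc zero) c = unchanged (zero , suc zero) c (λ p' → refl) refl
            e (suc p' , suc zero) (q , suc (suc l)) = replaceSummand (A6 (suc p' , suc zero) (q , suc (suc l))) refl (A6⊛N-row1 p' (q , suc (suc l)))
            e (suc p' , suc zero) (zero , zero) = replaceSummand (A6 (suc p' , suc zero) (zero , zero)) refl (A6⊛N-row1 p' (zero , zero))
            e (suc p' , suc zero) (suc q' , zero) = replaceSummand (A6 (suc p' , suc zero) (suc q' , zero)) (sym (ℤP.+-identityʳ (E p' q'))) (A6⊛N-row1 p' (suc q' , zero))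
            e (suc p' , suc zero) (zero , suc zero) = replaceSummand (A6 (suc p' , suc zero) (zero , suc zero)) (l1 t) (A6⊛N-row1 p' (zero , suc zero))
            e (suc p' , suc zero) (suc q' , suc zero) = replaceSummand (A6 (suc p' , suc zero) (suc q' , suc zero)) (l2 t (E p' q')) (A6⊛N-row1 p' (suc q' , suc zero))

        -- col (0 , 1) += Σ_p col (p+1 , 1)
        n8 : Fin M → C → ℤ
        n8 zero c = + 0
        n8 (suc p') (q , zero) = + 0
        n8 (suc p') (q , suc (suc l)) = + 0
        n8 (suc p') (zero , suc zero) = + 1
        n8 (suc p') (suc q' , suc zero) = + 0

        A8 : Mt
        A8 r (q , zero) = A7 r (q , zero)
        A8 r (q , suc (suc l)) = A7 r (q , suc (suc l))
        A8 r (suc q' , suc zero) = A7 r (suc q' , suc zero)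
        A8 (p , zero) (zero , suc zero) = + 0
        A8 (p , suc (suc k)) (zero , suc zero) = + 0
        A8 (zero , suc zero) (zero , suc zero) = t
        A8 (suc p' , suc zero) (zero , suc zero) = + 0

        A7~A8 : A7 ~ A8
        A7~A8 = colAddNilpotent {A7} N N⊛N≑𝟘 A8 e
          where
            N : Mt
            N = colsFromSlot (suc zero) n8
            N⊛N≑𝟘 : (N ⊛ N) ≑ 𝟘
            N⊛N≑𝟘 r c = trans (⊛-colsFromSlot (suc zero) n8 N r c) (Σ-≡0 (pt r))
              where
                    n8z : ∀ c → n8 zero c ≡ + 0
                    n8z (q , zero) = refl
                    n8z (q , suc zero) = refl
                    n8z (q , suc (suc l)) = refl
                    pt : ∀ r p → N r (p , suc zero) * n8 p c ≡ + 0
                    pt r zero = ℤP.*-zeroʳ (N r (zero , suc zero))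
                    pt (zero , k) (suc p) = trans (cong (λ z → E (suc zero) k * z * n8 (suc p) c) (n8z (suc p , suc zero)))
                                              (cong (_* n8 (suc p) c) (ℤP.*-zeroʳ (E (suc zero) k)))
                    pt (suc p' , k) (suc p) = cong (_* n8 (suc p) c) (ℤP.*-zeroʳ (E (suc zero) k))
            A7⊛N : ∀ r c → (A7 ⊛ N) r c ≡ Σℤ (λ p → A7 r (p , suc zero) * n8 p c)
            A7⊛N r c = ⊛-colsFromSlot (suc zero) n8 A7 r c
            unchanged : ∀ r c → (∀ p' → n8 (suc p') c ≡ + 0) → A8 r c ≡ A7 r c → A8 r c ≡ A7 r c + (A7 ⊛ N) r c
            unchanged r c h h' = trans h' (sym (trans (cong (_+_ (A7 r c)) (trans (A7⊛N r c)
                              (Σ-≡0 {M} {λ p → A7 r (p , suc zero) * n8 p c}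
                                 (λ { zero → ℤP.*-zeroʳ (A7 r (zero , suc zero)) ; (suc p') → trans (cong (A7 r (suc p' , suc zero) *_) (h p')) (ℤP.*-zeroʳ (A7 r (suc p' , suc zero))) })))) (ℤP.+-identityʳ (A7 r c))))
            A7⊛N-col01 : ∀ r → (A7 ⊛ N) r (zero , suc zero) ≡ Σℤ (λ p' → A7 r (suc p' , suc zero))
            A7⊛N-col01 r = trans (A7⊛N r (zero , suc zero)) (trans (cong (_+ Σℤ (λ p' → A7 r (suc p' , suc zero) * + 1)) (ℤP.*-zeroʳ (A7 r (zero , suc zero))))
                     (trans (ℤP.+-identityˡ _) (Σ-cong (λ p' → ℤP.*-identityʳ (A7 r (suc p' , suc zero))))))
            la : ∀ t s m2 → + 0 ≡ - (t * (s * (+ 1 + m2))) + (+ 1 + m2) * (s * t)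
            la = solve-∀
            pa : ∀ t s → - ((t * + 0 - s * (+ 1 - + 0)) * t) ≡ s * t
            pa = solve-∀
            lb : ∀ t s m2 → + 0 ≡ t * (t - s * m2) + (- ((t + s) * t) + (+ 1 + m2) * (s * t))
            lb = solve-∀
            pb : ∀ t s e → - ((t * e - s * (+ 1 - e)) * t) ≡ - ((t + s) * t) * e + s * t
            pb = solve-∀
            lc : ∀ t m2 → t ≡ (t - (+ 1 + m2) * t) + (+ 1 + m2) * t
            lc = solve-∀
            e : ∀ i j → A8 i j ≡ A7 i j + (A7 ⊛ N) i j
            e r (q , zero) = unchanged r (q , zero) (λ p' → refl) refl
            e r (q , suc (suc l)) = unchanged r (q , suc (suc l)) (λ p' → refl) refl
            e r (suc q' , suc zero) = unchanged r (suc q' , suc zero) (λ p' → refl) refl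
            e (zero , zero) (zero , suc zero) = replaceSummand (A7 (zero , zero) (zero , suc zero)) (la t s (+ m2))
                  (trans (A7⊛N-col01 (zero , zero)) (Σ-≡const {suc m2} (s * t) (λ p' → pa t s)))
            e (suc p , zero) (zero , suc zero) = replaceSummand (A7 (suc p , zero) (zero , suc zero)) (lb t s (+ m2))
                  (trans (A7⊛N-col01 (suc p , zero)) (trans (Σ-cong (λ p' → pb t s (E p p'))) (Σ-lin p (- ((t + s) * t)) (s * t))))
            e (p , suc (suc k)) (zero , suc zero) = replaceSummand (A7 (p , suc (suc k)) (zero , suc zero)) refl
                  (trans (A7⊛N-col01 (p , suc (suc k))) (Σ-≡0 {suc m2} {λ p' → A7 (p , suc (suc k)) (suc p' , suc zero)} (λ p' → refl)))
            e (zero , suc zero) (zero , suc zero) = replaceSummand (A7 (zero , suc zero) (zero , suc zero)) (lc t (+ m2))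
                  (trans (A7⊛N-col01 (zero , suc zero)) (Σ-≡const {suc m2} t (λ p' → refl)))
            e (suc p , suc zero) (zero , suc zero) = replaceSummand (A7 (suc p , suc zero) (zero , suc zero)) refl
                  (trans (A7⊛N-col01 (suc p , suc zero)) (Σ-≡0 {suc m2} {λ p' → A7 (suc p , suc zero) (suc p' , suc zero)} (λ p' → refl)))

        -- col (q+1 , 1) −= col (0 , 1)
        A9 : Mt
        A9 (p , suc (suc k)) c = A4 (p , suc (suc k)) c
        A9 (p , zero) (q , suc (suc l)) = + 0
        A9 (p , zero) (zero , zero) = t - s * m'
        A9 (p , zero) (suc q' , zero) = + 0
        A9 (p , zero) (zero , suc zero) = + 0
        A9 (p , zero) (suc q' , suc zero) = - (X p (suc q') * t)
        A9 (zero , suc zero) (q , suc (suc l)) = + 0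
        A9 (zero , suc zero) (zero , zero) = - m'
        A9 (zero , suc zero) (suc q' , zero) = + 0
        A9 (zero , suc zero) (zero , suc zero) = t
        A9 (zero , suc zero) (suc q' , suc zero) = + 0
        A9 (suc p' , suc zero) (q , suc (suc l)) = + 0
        A9 (suc p' , suc zero) (zero , zero) = + 0
        A9 (suc p' , suc zero) (suc q' , zero) = E p' q'
        A9 (suc p' , suc zero) (zero , suc zero) = + 0
        A9 (suc p' , suc zero) (suc q' , suc zero) = + 0

        A8~A9 : A8 ~ A9
        A8~A9 = colAdd {A8} src coef (λ r → ℤP.*-zeroʳ (coef r)) A9 e
          where
            src : C → C
            src _ = (zero , suc zero)
            coef : C → ℤ
            coef (q , zero) = + 0
            coef (q , suc (suc l)) = + 0
            coef (zero , suc zero) = + 0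
            coef (suc q' , suc zero) = - + 1
            unchanged : ∀ r c → A9 r c ≡ A8 r c → coef c ≡ + 0 → A9 r c ≡ A8 r c + A8 r (zero , suc zero) * coef c
            unchanged r c h h' = trans h (sym (trans (cong (λ z → A8 r c + A8 r (zero , suc zero) * z) h')
                            (trans (cong (_+_ (A8 r c)) (ℤP.*-zeroʳ (A8 r (zero , suc zero)))) (ℤP.+-identityʳ (A8 r c)))))
            l1 : ∀ t → + 0 ≡ t + t * (- + 1)
            l1 = solve-∀
            e : ∀ i j → A9 i j ≡ A8 i j + A8 i (src j) * coef j
            e (p , suc (suc k)) (q , zero) = unchanged (p , suc (suc k)) (q , zero) refl refl
            e (p , suc (suc k)) (q , suc (suc l)) = unchanged (p , suc (suc k)) (q , suc (suc l)) refl refl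
            e (p , suc (suc k)) (zero , suc zero) = unchanged (p , suc (suc k)) (zero , suc zero) refl refl
            e (p , suc (suc k)) (suc q' , suc zero) = refl
            e (p , zero) (zero , zero) = unchanged (p , zero) (zero , zero) refl refl
            e (p , zero) (suc q , zero) = unchanged (p , zero) (suc q , zero) refl refl
            e (p , zero) (q , suc (suc l)) = unchanged (p , zero) (q , suc (suc l)) refl refl
            e (p , zero) (zero , suc zero) = unchanged (p , zero) (zero , suc zero) refl refl
            e (p , zero) (suc q' , suc zero) = sym (ℤP.+-identityʳ (- (X p (suc q') * t)))
            e (zero , suc zero) (zero , zero) = unchanged (zero , suc zero) (zero , zero) refl refl
            e (zero , suc zero) (suc q , zero) = unchanged (zero , suc zero) (suc q , zero) refl refl
            e (zero , suc zero) (q , suc (suc l)) = unchanged (zero , suc zero) (q , suc (suc l)) refl refl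
            e (zero , suc zero) (zero , suc zero) = unchanged (zero , suc zero) (zero , suc zero) refl refl
            e (zero , suc zero) (suc q' , suc zero) = l1 t
            e (suc p' , suc zero) (zero , zero) = unchanged (suc p' , suc zero) (zero , zero) refl refl
            e (suc p' , suc zero) (suc q , zero) = unchanged (suc p' , suc zero) (suc q , zero) refl refl
            e (suc p' , suc zero) (q , suc (suc l)) = unchanged (suc p' , suc zero) (q , suc (suc l)) refl refl
            e (suc p' , suc zero) (zero , suc zero) = unchanged (suc p' , suc zero) (zero , suc zero) refl refl
            e (suc p' , suc zero) (suc q' , suc zero) = refl

        -- row (p+1 , 0) −= row (0 , 0)
        A10 : Mt
        A10 (p , suc k) c = A9 (p , suc k) c
        A10 (zero , zero) c = A9 (zero , zero) c
        A10 (suc p' , zero) (q , zero) = + 0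
        A10 (suc p' , zero) (q , suc (suc l)) = + 0
        A10 (suc p' , zero) (zero , suc zero) = + 0
        A10 (suc p' , zero) (suc q' , suc zero) = - (t * (t + s) * E p' q')

        A9~A10 : A9 ~ A10
        A9~A10 = rowAdd {A9} src coef (λ r → ℤP.*-zeroʳ (coef r)) A10 e
          where
            src : C → C
            src _ = (zero , zero)
            coef : C → ℤ
            coef (p , suc k) = + 0
            coef (zero , zero) = + 0
            coef (suc p' , zero) = - + 1
            l1 : ∀ x → + 0 ≡ x + (- + 1) * x
            l1 = solve-∀
            l2 : ∀ t s e → - (t * (t + s) * e) ≡ - ((t * e - s * (+ 1 - e)) * t) + (- + 1) * (- ((t * + 0 - s * (+ 1 - + 0)) * t))
            l2 = solve-∀
            e : ∀ i j → A10 i j ≡ A9 i j + coef i * A9 (src i) j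
            e (p , suc k) c = sym (ℤP.+-identityʳ (A9 (p , suc k) c))
            e (zero , zero) c = sym (ℤP.+-identityʳ (A9 (zero , zero) c))
            e (suc p' , zero) (zero , zero) = l1 (t - s * m')
            e (suc p' , zero) (suc q , zero) = refl
            e (suc p' , zero) (q , suc (suc l)) = refl
            e (suc p' , zero) (zero , suc zero) = refl
            e (suc p' , zero) (suc q' , suc zero) = l2 t s (E p' q')

        -- col (q+2 , 1) −= col (1 , 1)
        A11 : Mt
        A11 r (q , zero) = A10 r (q , zero)
        A11 r (q , suc (suc l)) = A10 r (q , suc (suc l))
        A11 r (zero , suc zero) = A10 r (zero , suc zero)
        A11 r (suc zero , suc zero) = A10 r (suc zero , suc zero)
        A11 (p , suc k) (suc (suc q) , suc zero) = + 0
        A11 (zero , zero) (suc (suc q) , suc zero) = + 0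
        A11 (suc zero , zero) (suc (suc q) , suc zero) = t * (t + s)
        A11 (suc (suc p) , zero) (suc (suc q) , suc zero) = - (t * (t + s) * E p q)

        A10~A11 : A10 ~ A11
        A10~A11 = colAdd {A10} src coef (λ r → ℤP.*-zeroʳ (coef r)) A11 e
          where
            src : C → C
            src _ = (suc zero , suc zero)
            coef : C → ℤ
            coef (q , zero) = + 0
            coef (q , suc (suc l)) = + 0
            coef (zero , suc zero) = + 0
            coef (suc zero , suc zero) = + 0
            coef (suc (suc q) , suc zero) = - + 1
            unchanged : ∀ r c → A11 r c ≡ A10 r c → coef c ≡ + 0 → A11 r c ≡ A10 r c + A10 r (suc zero , suc zero) * coef c
            unchanged r c h h' = trans h (sym (trans (cong (λ z → A10 r c + A10 r (suc zero , suc zero) * z) h')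
                            (trans (cong (_+_ (A10 r c)) (ℤP.*-zeroʳ (A10 r (suc zero , suc zero)))) (ℤP.+-identityʳ (A10 r c)))))
            l1 : ∀ x → + 0 ≡ x + x * (- + 1)
            l1 = solve-∀
            l2 : ∀ t s → t * (t + s) ≡ - (t * (t + s) * + 0) + - (t * (t + s) * + 1) * (- + 1)
            l2 = solve-∀
            l3 : ∀ t s e → - (t * (t + s) * e) ≡ - (t * (t + s) * e) + - (t * (t + s) * + 0) * (- + 1)
            l3 = solve-∀
            e : ∀ i j → A11 i j ≡ A10 i j + A10 i (src j) * coef j
            e r (q , zero) = unchanged r (q , zero) refl refl
            e r (q , suc (suc l)) = unchanged r (q , suc (suc l)) refl refl
            e r (zero , suc zero) = unchanged r (zero , suc zero) refl refl
            e r (suc zero , suc zero) = unchanged r (suc zero , suc zero) refl refl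
            e (p , suc (suc k)) (suc (suc q) , suc zero) = refl
            e (zero , suc zero) (suc (suc q) , suc zero) = refl
            e (suc p , suc zero) (suc (suc q) , suc zero) = refl
            e (zero , zero) (suc (suc q) , suc zero) = l1 (- (X zero (suc (suc q)) * t))
            e (suc zero , zero) (suc (suc q) , suc zero) = l2 t s
            e (suc (suc p) , zero) (suc (suc q) , suc zero) = l3 t s (E p q)

        -- row (1 , 0) += Σ_p row (p+2 , 0)
        n12 : Fin M → Fin Sn → Fin M → ℤ
        n12 p k zero = + 0
        n12 p k (suc zero) = + 0
        n12 zero k (suc (suc q)) = + 0
        n12 (suc zero) zero (suc (suc q)) = + 1
        n12 (suc zero) (suc k) (suc (suc q)) = + 0
        n12 (suc (suc p)) k (suc (suc q)) = + 0

        A12 : Mt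
        A12 (p , suc (suc k)) c = A4 (p , suc (suc k)) c
        A12 (zero , suc zero) c = A9 (zero , suc zero) c
        A12 (suc p' , suc zero) c = A9 (suc p' , suc zero) c
        A12 (p , zero) (q , suc (suc l)) = + 0
        A12 (p , zero) (zero , suc zero) = + 0
        A12 (p , zero) (suc q , zero) = + 0
        A12 (zero , zero) (zero , zero) = t - s * m'
        A12 (suc p , zero) (zero , zero) = + 0
        A12 (zero , zero) (suc zero , suc zero) = - (X zero (suc zero) * t)
        A12 (zero , zero) (suc (suc q) , suc zero) = + 0
        A12 (suc zero , zero) (suc zero , suc zero) = - (t * (t + s))
        A12 (suc zero , zero) (suc (suc q) , suc zero) = + 0
        A12 (suc (suc p) , zero) (suc zero , suc zero) = + 0
        A12 (suc (suc p) , zero) (suc (suc q) , suc zero) = - (t * (t + s) * E p q)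

        A11~A12 : A11 ~ A12
        A11~A12 = rowAddNilpotent {A11} N N⊛N≑𝟘 A12 e
          where
            N : Mt
            N = rowsFromSlot zero n12
            N⊛N≑𝟘 : (N ⊛ N) ≑ 𝟘
            N⊛N≑𝟘 (p , k) (q2 , l2) = trans (rowsFromSlot-⊛ zero n12 N (p , k) (q2 , l2)) (Σ-≡0 (pt q2))
              where pt : ∀ q2 q → n12 p k q * N (q , zero) (q2 , l2) ≡ + 0
                    pt q2 zero = refl
                    pt q2 (suc zero) = refl
                    pt zero (suc (suc q)) = ℤP.*-zeroʳ (n12 p k (suc (suc q)))
                    pt (suc zero) (suc (suc q)) = ℤP.*-zeroʳ (n12 p k (suc (suc q)))
                    pt (suc (suc q2)) (suc (suc q)) = ℤP.*-zeroʳ (n12 p k (suc (suc q)))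
            N⊛A11 : ∀ p k c → (N ⊛ A11) (p , k) c ≡ Σℤ (λ q → n12 p k q * A11 (q , zero) c)
            N⊛A11 p k c = rowsFromSlot-⊛ zero n12 A11 (p , k) c
            unchanged : ∀ p k c → (∀ q → n12 p k q * A11 (q , zero) c ≡ + 0) → A12 (p , k) c ≡ A11 (p , k) c →
                 A12 (p , k) c ≡ A11 (p , k) c + (N ⊛ A11) (p , k) c
            unchanged p k c h h' = trans h' (sym (trans (cong (_+_ (A11 (p , k) c)) (trans (N⊛A11 p k c) (Σ-≡0 h))) (ℤP.+-identityʳ (A11 (p , k) c))))
            N⊛A11-row10 : ∀ c → (N ⊛ A11) (suc zero , zero) c ≡ Σℤ (λ q → A11 (suc (suc q) , zero) c)
            N⊛A11-row10 c = trans (N⊛A11 (suc zero) zero c) (trans (ℤP.+-identityˡ _) (trans (ℤP.+-identityˡ _)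
                     (Σ-cong (λ q → ℤP.*-identityˡ (A11 (suc (suc q) , zero) c)))))
            l1 : ∀ t s → - (t * (t + s)) ≡ - (t * (t + s) * + 1) + + 0
            l1 = solve-∀
            p1 : ∀ t s → - (t * (t + s) * + 0) ≡ + 0
            p1 = solve-∀
            l2 : ∀ t s → + 0 ≡ t * (t + s) + - (t * (t + s))
            l2 = solve-∀
            p2 : ∀ t s e → - (t * (t + s) * e) ≡ - (t * (t + s)) * e
            p2 = solve-∀
            unchangedRow : ∀ p k → (∀ c → A12 (p , k) c ≡ A11 (p , k) c) → (∀ q → n12 p k q ≡ + 0) → ∀ c → A12 (p , k) c ≡ A11 (p , k) c + (N ⊛ A11) (p , k) c
            unchangedRow p k h h2 c = unchanged p k c (λ q → trans (cong (_* A11 (q , zero) c) (h2 q)) refl) (h c)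
            e : ∀ i j → A12 i j ≡ A11 i j + (N ⊛ A11) i j
            e (p , suc (suc k)) = unchangedRow p (suc (suc k))
               (λ { (q , zero) → refl ; (q , suc (suc l)) → refl ; (zero , suc zero) → refl ; (suc zero , suc zero) → refl ; (suc (suc q) , suc zero) → refl })
               (λ { zero → refl ; (suc zero) → refl ; (suc (suc q)) → n12z p k q })
              where n12z : ∀ p k q → n12 p (suc (suc k)) (suc (suc q)) ≡ + 0
                    n12z zero k q = refl
                    n12z (suc zero) k q = refl
                    n12z (suc (suc p)) k q = refl
            e (zero , suc zero) = unchangedRow zero (suc zero)
               (λ { (q , zero) → refl ; (q , suc (suc l)) → refl ; (zero , suc zero) → refl ; (suc zero , suc zero) → refl ; (suc (suc q) , suc zero) → refl })
               (λ { zero → refl ; (suc zero) → refl ; (suc (suc q)) → refl })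
            e (suc p' , suc zero) = unchangedRow (suc p') (suc zero)
               (λ { (q , zero) → refl ; (q , suc (suc l)) → refl ; (zero , suc zero) → refl ; (suc zero , suc zero) → refl ; (suc (suc q) , suc zero) → refl })
               (λ { zero → refl ; (suc zero) → refl ; (suc (suc q)) → n12z p' q })
              where n12z : ∀ p' q → n12 (suc p') (suc zero) (suc (suc q)) ≡ + 0
                    n12z zero q = refl
                    n12z (suc p) q = refl
            e (zero , zero) = unchangedRow zero zero
               (λ { (zero , zero) → refl ; (suc q , zero) → refl ; (q , suc (suc l)) → refl ; (zero , suc zero) → refl ; (suc zero , suc zero) → refl ; (suc (suc q) , suc zero) → refl })
               (λ { zero → refl ; (suc zero) → refl ; (suc (suc q)) → refl })
            e (suc (suc p) , zero) = unchangedRow (suc (suc p)) zero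
               (λ { (zero , zero) → refl ; (suc q , zero) → refl ; (q , suc (suc l)) → refl ; (zero , suc zero) → refl ; (suc zero , suc zero) → sym (p1 t s) ; (suc (suc q) , suc zero) → refl })
               (λ { zero → refl ; (suc zero) → refl ; (suc (suc q)) → refl })
            e (suc zero , zero) (zero , zero) = replaceSummand (A11 (suc zero , zero) (zero , zero)) refl (trans (N⊛A11-row10 (zero , zero)) (Σ-≡0 {m2} (λ q → refl)))
            e (suc zero , zero) (suc q' , zero) = replaceSummand (A11 (suc zero , zero) (suc q' , zero)) refl (trans (N⊛A11-row10 (suc q' , zero)) (Σ-≡0 {m2} (λ q → refl)))
            e (suc zero , zero) (q' , suc (suc l)) = replaceSummand (A11 (suc zero , zero) (q' , suc (suc l))) refl (trans (N⊛A11-row10 (q' , suc (suc l))) (Σ-≡0 {m2} (λ q → refl)))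
            e (suc zero , zero) (zero , suc zero) = replaceSummand (A11 (suc zero , zero) (zero , suc zero)) refl (trans (N⊛A11-row10 (zero , suc zero)) (Σ-≡0 {m2} (λ q → refl)))
            e (suc zero , zero) (suc zero , suc zero) = replaceSummand (A11 (suc zero , zero) (suc zero , suc zero)) (l1 t s)
                 (trans (N⊛A11-row10 (suc zero , suc zero)) (Σ-≡0 {m2} (λ q → p1 t s)))
            e (suc zero , zero) (suc (suc q') , suc zero) = replaceSummand (A11 (suc zero , zero) (suc (suc q') , suc zero)) (l2 t s)
                 (trans (N⊛A11-row10 (suc (suc q') , suc zero)) (trans (Σ-cong (λ q → p2 t s (E q q'))) (Σ-δ' q' (λ _ → - (t * (t + s))))))

        -- The pivots come from two Bézout identities: a = gcd (m − 1) (t − s (m − 1)) and g = gcd v (u s).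
        module Pivots (a x y u v w g ξ η U V h : ℤ)
                    (m-1≡a*u : m' ≡ a * u) (t-s[m-1]≡a*v : t - s * m' ≡ a * v) (t≡a*w : t ≡ a * w) (x*u+y*v≡1 : x * u + y * v ≡ + 1)
                    (v≡g*V : v ≡ g * V) (u*s≡g*U : u * s ≡ g * U) (t+s≡g*h : t + s ≡ g * h) (ξ*V+η*U≡1 : ξ * V + η * U ≡ + 1) where

          i1 i2 : C
          i1 = (zero , zero)
          i2 = (zero , suc zero)
          open TwoRows i1 i2 refl

          a*0+b*0≡0 : ∀ a b → a * + 0 + b * + 0 ≡ + 0
          a*0+b*0≡0 = solve-∀

          -- (row (0 , 0) , row (0 , 1)) := (y · row (0 , 0) − x · row (0 , 1) , u · row (0 , 0) + v · row (0 , 1))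
          A13 : Mt
          A13 (p , suc (suc k)) c = A12 (p , suc (suc k)) c
          A13 (suc p' , suc zero) c = A12 (suc p' , suc zero) c
          A13 (zero , suc zero) (q , suc (suc l)) = + 0
          A13 (zero , suc zero) (q , zero) = + 0
          A13 (zero , suc zero) (zero , suc zero) = v * t
          A13 (zero , suc zero) (suc zero , suc zero) = u * (s * t)
          A13 (zero , suc zero) (suc (suc q) , suc zero) = + 0
          A13 (suc p , zero) c = A12 (suc p , zero) c
          A13 (zero , zero) (q , suc (suc l)) = + 0
          A13 (zero , zero) (zero , zero) = a
          A13 (zero , zero) (suc q , zero) = + 0
          A13 (zero , zero) (zero , suc zero) = - (x * t)
          A13 (zero , zero) (suc zero , suc zero) = y * (s * t)
          A13 (zero , zero) (suc (suc q) , suc zero) = + 0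

          A12~A13 : A12 ~ A13
          A12~A13 = ~-trans {A12} {mixRows y (- x) u v A12} {A13} (rowMix {A12} y (- x) u v det) (≑⇒~ {mixRows y (- x) u v A12} {A13} eq)
            where
              det : y * v - (- x) * u ≡ + 1
              det = trans (l x y u v) x*u+y*v≡1
                where l : ∀ x y u v → y * v - (- x) * u ≡ x * u + y * v
                      l = solve-∀
              e00 : y * (t - s * m') + (- x) * (- m') ≡ a
              e00 = trans (cong₂ (λ P Q → y * P + (- x) * (- Q)) t-s[m-1]≡a*v m-1≡a*u)
                     (trans (l a x y u v) (trans (cong (a *_) x*u+y*v≡1) (ℤP.*-identityʳ a)))
                where l : ∀ a x y u v → y * (a * v) + (- x) * (- (a * u)) ≡ a * (x * u + y * v)
                      l = solve-∀
              e20 : u * (t - s * m') + v * (- m') ≡ + 0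
              e20 = trans (cong₂ (λ P Q → u * P + v * (- Q)) t-s[m-1]≡a*v m-1≡a*u) (l a u v)
                where l : ∀ a u v → u * (a * v) + v * (- (a * u)) ≡ + 0
                      l = solve-∀
              l01 : ∀ x y t → y * + 0 + (- x) * t ≡ - (x * t)
              l01 = solve-∀
              l11 : ∀ x y t s → y * (- ((t * + 0 - s * (+ 1 - + 0)) * t)) + (- x) * + 0 ≡ y * (s * t)
              l11 = solve-∀
              l21 : ∀ u v t → u * + 0 + v * t ≡ v * t
              l21 = solve-∀
              l22 : ∀ u v t s → u * (- ((t * + 0 - s * (+ 1 - + 0)) * t)) + v * + 0 ≡ u * (s * t)
              l22 = solve-∀
              eq : mixRows y (- x) u v A12 ≑ A13
              eq (zero , suc (suc k)) c = refl
              eq (suc p , suc (suc k)) c = refl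
              eq (suc p' , suc zero) c = refl
              eq (suc p , zero) c = refl
              eq (zero , suc zero) (q , suc (suc l)) = a*0+b*0≡0 u v
              eq (zero , suc zero) (zero , zero) = e20
              eq (zero , suc zero) (suc q , zero) = a*0+b*0≡0 u v
              eq (zero , suc zero) (zero , suc zero) = l21 u v t
              eq (zero , suc zero) (suc zero , suc zero) = l22 u v t s
              eq (zero , suc zero) (suc (suc q) , suc zero) = a*0+b*0≡0 u v
              eq (zero , zero) (q , suc (suc l)) = a*0+b*0≡0 y (- x)
              eq (zero , zero) (zero , zero) = e00
              eq (zero , zero) (suc q , zero) = a*0+b*0≡0 y (- x)
              eq (zero , zero) (zero , suc zero) = l01 x y t
              eq (zero , zero) (suc zero , suc zero) = l11 x y t s
              eq (zero , zero) (suc (suc q) , suc zero) = a*0+b*0≡0 y (- x)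

          -- col (0 , 1) += x w · col (0 , 0);  col (1 , 1) −= y w s · col (0 , 0)
          A14 : Mt
          A14 r (q , zero) = A13 r (q , zero)
          A14 r (q , suc (suc l)) = A13 r (q , suc (suc l))
          A14 r (suc (suc q) , suc zero) = A13 r (suc (suc q) , suc zero)
          A14 (p , suc k) (zero , suc zero) = A13 (p , suc k) (zero , suc zero)
          A14 (p , suc k) (suc zero , suc zero) = A13 (p , suc k) (suc zero , suc zero)
          A14 (suc p , zero) (zero , suc zero) = A13 (suc p , zero) (zero , suc zero)
          A14 (suc p , zero) (suc zero , suc zero) = A13 (suc p , zero) (suc zero , suc zero)
          A14 (zero , zero) (zero , suc zero) = + 0
          A14 (zero , zero) (suc zero , suc zero) = + 0

          A13~A14 : A13 ~ A14
          A13~A14 = colAdd {A13} src coef (λ r → ℤP.*-zeroʳ (coef r)) A14 e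
            where
              src : C → C
              src _ = (zero , zero)
              coef : C → ℤ
              coef (q , zero) = + 0
              coef (q , suc (suc l)) = + 0
              coef (zero , suc zero) = x * w
              coef (suc zero , suc zero) = - (y * w * s)
              coef (suc (suc q) , suc zero) = + 0
              unchanged : ∀ r c → coef c ≡ + 0 → A14 r c ≡ A13 r c → A14 r c ≡ A13 r c + A13 r (zero , zero) * coef c
              unchanged r c h h' = trans h' (sym (trans (cong (λ z → A13 r c + A13 r (zero , zero) * z) h)
                              (trans (cong (_+_ (A13 r c)) (ℤP.*-zeroʳ (A13 r (zero , zero)))) (ℤP.+-identityʳ (A13 r c)))))
              e01 : + 0 ≡ - (x * t) + a * (x * w)
              e01 = trans (l a x w) (cong (λ T → - (x * T) + a * (x * w)) (sym t≡a*w))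
                where l : ∀ a x w → + 0 ≡ - (x * (a * w)) + a * (x * w)
                      l = solve-∀
              e11 : + 0 ≡ y * (s * t) + a * (- (y * w * s))
              e11 = trans (l a y w s) (cong (λ T → y * (s * T) + a * (- (y * w * s))) (sym t≡a*w))
                where l : ∀ a y w s → + 0 ≡ y * (s * (a * w)) + a * (- (y * w * s))
                      l = solve-∀
              e : ∀ i j → A14 i j ≡ A13 i j + A13 i (src j) * coef j
              e r (q , zero) = unchanged r (q , zero) refl refl
              e r (q , suc (suc l)) = unchanged r (q , suc (suc l)) refl refl
              e r (suc (suc q) , suc zero) = unchanged r (suc (suc q) , suc zero) refl refl
              e (p , suc (suc k)) (zero , suc zero) = sym (ℤP.+-identityʳ (A13 (p , suc (suc k)) (zero , suc zero)))
              e (zero , suc zero) (zero , suc zero) = sym (ℤP.+-identityʳ (A13 (zero , suc zero) (zero , suc zero)))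
              e (suc p , suc zero) (zero , suc zero) = sym (ℤP.+-identityʳ (A13 (suc p , suc zero) (zero , suc zero)))
              e (p , suc (suc k)) (suc zero , suc zero) = sym (ℤP.+-identityʳ (A13 (p , suc (suc k)) (suc zero , suc zero)))
              e (zero , suc zero) (suc zero , suc zero) = sym (ℤP.+-identityʳ (A13 (zero , suc zero) (suc zero , suc zero)))
              e (suc p , suc zero) (suc zero , suc zero) = sym (ℤP.+-identityʳ (A13 (suc p , suc zero) (suc zero , suc zero)))
              e (suc p , zero) (zero , suc zero) = sym (ℤP.+-identityʳ (A13 (suc p , zero) (zero , suc zero)))
              e (suc p , zero) (suc zero , suc zero) = sym (ℤP.+-identityʳ (A13 (suc p , zero) (suc zero , suc zero)))
              e (zero , zero) (zero , suc zero) = e01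
              e (zero , zero) (suc zero , suc zero) = e11

          -- Bézout combination of col (0 , 1) and col (1 , 1)
          j1 j2 : C
          j1 = (zero , suc zero)
          j2 = (suc zero , suc zero)
          module Cols = TwoRows j1 j2 refl

          A15 : Mt
          A15 r (q , zero) = A14 r (q , zero)
          A15 r (q , suc (suc l)) = A14 r (q , suc (suc l))
          A15 r (suc (suc q) , suc zero) = A14 r (suc (suc q) , suc zero)
          A15 (p , suc (suc k)) (zero , suc zero) = + 0
          A15 (p , suc (suc k)) (suc zero , suc zero) = + 0
          A15 (zero , suc zero) (zero , suc zero) = g * t
          A15 (zero , suc zero) (suc zero , suc zero) = + 0
          A15 (suc p , suc zero) (zero , suc zero) = + 0
          A15 (suc p , suc zero) (suc zero , suc zero) = + 0
          A15 (zero , zero) (zero , suc zero) = + 0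
          A15 (zero , zero) (suc zero , suc zero) = + 0
          A15 (suc zero , zero) (zero , suc zero) = η * (- (t * (t + s)))
          A15 (suc zero , zero) (suc zero , suc zero) = V * (- (t * (t + s)))
          A15 (suc (suc p) , zero) (zero , suc zero) = + 0
          A15 (suc (suc p) , zero) (suc zero , suc zero) = + 0

          A14~A15 : A14 ~ A15
          A14~A15 = ~-trans {A14} {B} {A15} (Cols.colMix {A14} ξ η (- U) V det) (≑⇒~ {B} {A15} eq)
            where
              B : Mt
              B = ᵀ (Cols.mixRows ξ η (- U) V (ᵀ A14))
              det : ξ * V - η * (- U) ≡ + 1
              det = trans (l ξ η U V) ξ*V+η*U≡1
                where l : ∀ ξ η U V → ξ * V - η * (- U) ≡ ξ * V + η * U
                      l = solve-∀
              g1 : ξ * (v * t) + η * (u * (s * t)) ≡ g * t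
              g1 = trans (l ξ η u v s t) (trans (cong₂ (λ P Q → ξ * (P * t) + η * (Q * t)) v≡g*V u*s≡g*U)
                     (trans (l2 ξ η g U V t) (trans (cong (λ z → g * t * z) ξ*V+η*U≡1) (ℤP.*-identityʳ (g * t)))))
                where l : ∀ ξ η u v s t → ξ * (v * t) + η * (u * (s * t)) ≡ ξ * (v * t) + η * ((u * s) * t)
                      l = solve-∀
                      l2 : ∀ ξ η g U V t → ξ * ((g * V) * t) + η * ((g * U) * t) ≡ g * t * (ξ * V + η * U)
                      l2 = solve-∀
              g2 : (- U) * (v * t) + V * (u * (s * t)) ≡ + 0
              g2 = trans (l U V u v s t) (trans (cong₂ (λ P Q → (- U) * (P * t) + V * (Q * t)) v≡g*V u*s≡g*U) (l2 g U V t))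
                where l : ∀ U V u v s t → (- U) * (v * t) + V * (u * (s * t)) ≡ (- U) * (v * t) + V * ((u * s) * t)
                      l = solve-∀
                      l2 : ∀ g U V t → (- U) * ((g * V) * t) + V * ((g * U) * t) ≡ + 0
                      l2 = solve-∀
              h1 : ∀ ξ η T → ξ * + 0 + η * T ≡ η * T
              h1 = solve-∀
              eq : B ≑ A15
              eq r (zero , zero) = refl
              eq r (suc zero , zero) = refl
              eq r (suc (suc q) , zero) = refl
              eq r (zero , suc (suc l)) = refl
              eq r (suc zero , suc (suc l)) = refl
              eq r (suc (suc q) , suc (suc l)) = refl
              eq r (suc (suc q) , suc zero) = refl
              eq (zero , suc (suc k)) (zero , suc zero) = a*0+b*0≡0 ξ η
              eq (suc p , suc (suc k)) (zero , suc zero) = a*0+b*0≡0 ξ η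
              eq (zero , suc (suc k)) (suc zero , suc zero) = a*0+b*0≡0 (- U) V
              eq (suc p , suc (suc k)) (suc zero , suc zero) = a*0+b*0≡0 (- U) V
              eq (zero , suc zero) (zero , suc zero) = g1
              eq (zero , suc zero) (suc zero , suc zero) = g2
              eq (suc p , suc zero) (zero , suc zero) = a*0+b*0≡0 ξ η
              eq (suc p , suc zero) (suc zero , suc zero) = a*0+b*0≡0 (- U) V
              eq (zero , zero) (zero , suc zero) = a*0+b*0≡0 ξ η
              eq (zero , zero) (suc zero , suc zero) = a*0+b*0≡0 (- U) V
              eq (suc zero , zero) (zero , suc zero) = h1 ξ η (- (t * (t + s)))
              eq (suc zero , zero) (suc zero , suc zero) = h1 (- U) V (- (t * (t + s)))
              eq (suc (suc p) , zero) (zero , suc zero) = a*0+b*0≡0 ξ η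
              eq (suc (suc p) , zero) (suc zero , suc zero) = a*0+b*0≡0 (- U) V

          -- row (1 , 0) += η h · row (0 , 1)
          A16 : Mt
          A16 (p , suc k) c = A15 (p , suc k) c
          A16 (zero , zero) c = A15 (zero , zero) c
          A16 (suc (suc p) , zero) c = A15 (suc (suc p) , zero) c
          A16 (suc zero , zero) (q , zero) = A15 (suc zero , zero) (q , zero)
          A16 (suc zero , zero) (q , suc (suc l)) = A15 (suc zero , zero) (q , suc (suc l))
          A16 (suc zero , zero) (suc q , suc zero) = A15 (suc zero , zero) (suc q , suc zero)
          A16 (suc zero , zero) (zero , suc zero) = + 0

          A15~A16 : A15 ~ A16
          A15~A16 = rowAdd {A15} src coef (λ r → ℤP.*-zeroʳ (coef r)) A16 e
            where
              src : C → C
              src _ = (zero , suc zero)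
              coef : C → ℤ
              coef (p , suc k) = + 0
              coef (zero , zero) = + 0
              coef (suc zero , zero) = η * h
              coef (suc (suc p) , zero) = + 0
              unchanged : ∀ c → A15 (zero , suc zero) c ≡ + 0 → A16 (suc zero , zero) c ≡ A15 (suc zero , zero) c →
                   A16 (suc zero , zero) c ≡ A15 (suc zero , zero) c + η * h * A15 (zero , suc zero) c
              unchanged c h1 h2 = trans h2 (sym (trans (cong (λ z → A15 (suc zero , zero) c + η * h * z) h1)
                              (trans (cong (_+_ (A15 (suc zero , zero) c)) (ℤP.*-zeroʳ (η * h))) (ℤP.+-identityʳ (A15 (suc zero , zero) c)))))
              e01 : + 0 ≡ η * (- (t * (t + s))) + η * h * (g * t)
              e01 = trans (l η h g t) (cong (λ T → η * (- (t * T)) + η * h * (g * t)) (sym t+s≡g*h))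
                where l : ∀ η h g t → + 0 ≡ η * (- (t * (g * h))) + η * h * (g * t)
                      l = solve-∀
              e : ∀ i j → A16 i j ≡ A15 i j + coef i * A15 (src i) j
              e (p , suc k) c = sym (ℤP.+-identityʳ (A15 (p , suc k) c))
              e (zero , zero) c = sym (ℤP.+-identityʳ (A15 (zero , zero) c))
              e (suc (suc p) , zero) c = sym (ℤP.+-identityʳ (A15 (suc (suc p) , zero) c))
              e (suc zero , zero) (zero , zero) = unchanged (zero , zero) refl refl
              e (suc zero , zero) (suc q , zero) = unchanged (suc q , zero) refl refl
              e (suc zero , zero) (q , suc (suc l)) = unchanged (q , suc (suc l)) refl refl
              e (suc zero , zero) (suc zero , suc zero) = unchanged (suc zero , suc zero) refl refl
              e (suc zero , zero) (suc (suc q) , suc zero) = unchanged (suc (suc q) , suc zero) refl refl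
              e (suc zero , zero) (zero , suc zero) = e01

          ε : C → ℤ
          ε (p , suc k) = + 1
          ε (zero , zero) = + 1
          ε (suc p , zero) = - + 1

          A17 : Mt
          A17 i j = ε i * A16 i j

          A16~A17 : A16 ~ A17
          A16~A17 = rowScale {A16} ε εε
            where εε : ∀ x → ε x * ε x ≡ + 1
                  εε (p , suc k) = refl
                  εε (zero , zero) = refl
                  εε (suc p , zero) = refl

          π : C → C
          π (p , suc (suc k)) = (p , suc (suc k))
          π (zero , k) = (zero , k)
          π (suc p , zero) = (suc p , suc zero)
          π (suc p , suc zero) = (suc p , zero)

          ππ : ∀ x → π (π x) ≡ x
          ππ (p , suc (suc k)) = refl
          ππ (zero , zero) = refl
          ππ (zero , suc zero) = refl
          ππ (suc p , zero) = refl
          ππ (suc p , suc zero) = refl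

          A18 : Mt
          A18 i j = A17 i (π j)

          A17~A18 : A17 ~ A18
          A17~A18 = colPermute {A17} π π ππ ππ

          dval : C → ℤ
          dval (p , suc (suc k)) = t
          dval (zero , zero) = a
          dval (zero , suc zero) = g * t
          dval (suc zero , zero) = V * (t * (t + s))
          dval (suc (suc p) , zero) = t * (t + s)
          dval (suc p , suc zero) = + 1

          D : Mt
          D r c = ind (eqbP r c) * dval r

          ind[b∧false]*x≡0 : ∀ b x → ind (b ∧ false) * x ≡ + 0
          ind[b∧false]*x≡0 true x = refl
          ind[b∧false]*x≡0 false x = refl

          A18≑D : A18 ≑ D
          A18≑D (p , suc (suc k)) (q , suc (suc l)) = trans (lm t (E p q) (E k l)) (cong (_* t) (sym (ind-∧ (δ p q) (δ k l))))
            where lm : ∀ t a b → + 1 * (t * a * b) ≡ a * b * t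
                  lm = solve-∀
          A18≑D (p , suc (suc k)) (zero , zero) = sym (ind[b∧false]*x≡0 (δ p zero) t)
          A18≑D (p , suc (suc k)) (suc zero , zero) = sym (ind[b∧false]*x≡0 (δ p (suc zero)) t)
          A18≑D (p , suc (suc k)) (suc (suc q) , zero) = sym (ind[b∧false]*x≡0 (δ p (suc (suc q))) t)
          A18≑D (p , suc (suc k)) (zero , suc zero) = sym (ind[b∧false]*x≡0 (δ p zero) t)
          A18≑D (p , suc (suc k)) (suc q , suc zero) = sym (ind[b∧false]*x≡0 (δ p (suc q)) t)
          A18≑D (suc p , suc zero) (suc q , suc zero) = trans (ℤP.*-identityˡ (E p q)) (trans (sym (ℤP.*-identityʳ (E p q))) (cong (λ b → ind b * + 1) (sym (∧-identityʳ (δ p q)))))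
          A18≑D (suc p , suc zero) (zero , zero) = refl
          A18≑D (suc p , suc zero) (suc zero , zero) = sym (ind[b∧false]*x≡0 (δ p zero) (+ 1))
          A18≑D (suc p , suc zero) (suc (suc q) , zero) = sym (ind[b∧false]*x≡0 (δ p (suc q)) (+ 1))
          A18≑D (suc p , suc zero) (zero , suc zero) = refl
          A18≑D (suc p , suc zero) (q , suc (suc l)) = sym (ind[b∧false]*x≡0 (δ (suc p) q) (+ 1))
          A18≑D (zero , suc zero) (zero , suc zero) = refl
          A18≑D (zero , suc zero) (suc q , suc zero) = refl
          A18≑D (zero , suc zero) (zero , zero) = refl
          A18≑D (zero , suc zero) (suc zero , zero) = refl
          A18≑D (zero , suc zero) (suc (suc q) , zero) = refl
          A18≑D (zero , suc zero) (q , suc (suc l)) = sym (ind[b∧false]*x≡0 (δ zero q) (g * t))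
          A18≑D (zero , zero) (zero , zero) = refl
          A18≑D (zero , zero) (suc zero , zero) = refl
          A18≑D (zero , zero) (suc (suc q) , zero) = refl
          A18≑D (zero , zero) (zero , suc zero) = refl
          A18≑D (zero , zero) (suc q , suc zero) = refl
          A18≑D (zero , zero) (q , suc (suc l)) = sym (ind[b∧false]*x≡0 (δ zero q) a)
          A18≑D (suc zero , zero) (suc zero , zero) = l V t s
            where l : ∀ V t s → - + 1 * (V * (- (t * (t + s)))) ≡ + 1 * (V * (t * (t + s)))
                  l = solve-∀
          A18≑D (suc zero , zero) (zero , zero) = refl
          A18≑D (suc zero , zero) (suc (suc q) , zero) = refl
          A18≑D (suc zero , zero) (zero , suc zero) = refl
          A18≑D (suc zero , zero) (suc q , suc zero) = sym (ind[b∧false]*x≡0 (δ zero q) (V * (t * (t + s))))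
          A18≑D (suc zero , zero) (q , suc (suc l)) = sym (ind[b∧false]*x≡0 (δ (suc zero) q) (V * (t * (t + s))))
          A18≑D (suc (suc p) , zero) (suc (suc q) , zero) = trans (l t s (E p q)) (cong (λ b → ind b * (t * (t + s))) (sym (∧-identityʳ (δ p q))))
            where l : ∀ t s e → - + 1 * (- (t * (t + s) * e)) ≡ e * (t * (t + s))
                  l = solve-∀
          A18≑D (suc (suc p) , zero) (zero , zero) = refl
          A18≑D (suc (suc p) , zero) (suc zero , zero) = refl
          A18≑D (suc (suc p) , zero) (zero , suc zero) = refl
          A18≑D (suc (suc p) , zero) (suc q , suc zero) = sym (ind[b∧false]*x≡0 (δ (suc (suc p)) (suc q)) (t * (t + s)))
          A18≑D (suc (suc p) , zero) (q , suc (suc l)) = sym (ind[b∧false]*x≡0 (δ (suc (suc p)) q) (t * (t + s)))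

          A0~D : A0 ~ D
          A0~D = (~-trans {A0} {A1} {D} A0~A1
            (~-trans {A1} {A2} {D} A1~A2
            (~-trans {A2} {A3} {D} A2~A3
            (~-trans {A3} {A4} {D} A3~A4
            (~-trans {A4} {A5} {D} A4~A5
            (~-trans {A5} {A6} {D} A5~A6
            (~-trans {A6} {A7} {D} A6~A7
            (~-trans {A7} {A8} {D} A7~A8
            (~-trans {A8} {A9} {D} A8~A9
            (~-trans {A9} {A10} {D} A9~A10
            (~-trans {A10} {A11} {D} A10~A11
            (~-trans {A11} {A12} {D} A11~A12
            (~-trans {A12} {A13} {D} A12~A13
            (~-trans {A13} {A14} {D} A13~A14
            (~-trans {A14} {A15} {D} A14~A15
            (~-trans {A15} {A16} {D} A15~A16
            (~-trans {A16} {A17} {D} A16~A17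
            (~-trans {A17} {A18} {D} A17~A18
            (≑⇒~ {A18} {D} A18≑D)))))))))))))))))))

  module Reordering where

    open Equivalence
    open Flattening

    nth-rep : ∀ {n} (x : ℤ) ys (j : Fin n) → nth (replicate n x ++ ys) (toℕ j) ≡ x
    nth-rep x ys zero = refl
    nth-rep x ys (suc j) = nth-rep x ys j

    nth-++ʳ : ∀ n (x : ℤ) ys k → nth (replicate n x ++ ys) (n ℕ.+ k) ≡ nth ys k
    nth-++ʳ zero x ys k = refl
    nth-++ʳ (suc n) x ys k = nth-++ʳ n x ys k

    -- σ enumerates the pair indices in the order of the diagonal of the theorem: the entries 1 at
    -- (p+1 , 1), a at (0 , 0), t at (p , k+2), g t at (0 , 1), t (t + s) at (p+2 , 0) and the last one at (1 , 0).
    module Layout (m2 s2 : ℕ) where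
      M Sn n1 n2 n3 K : ℕ
      M = suc (suc m2)
      Sn = suc (suc s2)
      n1 = suc m2
      n2 = M ℕ.* s2
      n3 = m2
      K = n1 ℕ.+ suc (n2 ℕ.+ suc (n3 ℕ.+ 1))

      C' : Set
      C' = Fin M × Fin Sn

      σ3 : Fin n3 ⊎ Fin 1 → C'
      σ3 (inj₁ j) = (suc (suc j) , zero)
      σ3 (inj₂ zero) = (suc zero , zero)

      σ2 : Fin n2 ⊎ Fin (suc (n3 ℕ.+ 1)) → C'
      σ2 (inj₁ j) = (proj₁ (remQuot {M} s2 j) , suc (suc (proj₂ (remQuot {M} s2 j))))
      σ2 (inj₂ zero) = (zero , suc zero)
      σ2 (inj₂ (suc r)) = σ3 (splitAt n3 r)

      σ1 : Fin n1 ⊎ Fin (suc (n2 ℕ.+ suc (n3 ℕ.+ 1))) → C'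
      σ1 (inj₁ j) = (suc j , suc zero)
      σ1 (inj₂ zero) = (zero , zero)
      σ1 (inj₂ (suc r)) = σ2 (splitAt n2 r)

      σ : Fin K → C'
      σ i = σ1 (splitAt n1 i)

      τ : C' → Fin K
      τ (p , suc (suc k)) = n1 ↑ʳ suc (combine p k ↑ˡ suc (n3 ℕ.+ 1))
      τ (zero , zero) = n1 ↑ʳ zero
      τ (zero , suc zero) = n1 ↑ʳ suc (n2 ↑ʳ zero)
      τ (suc p , suc zero) = p ↑ˡ suc (n2 ℕ.+ suc (n3 ℕ.+ 1))
      τ (suc zero , zero) = n1 ↑ʳ suc (n2 ↑ʳ suc (n3 ↑ʳ zero))
      τ (suc (suc p) , zero) = n1 ↑ʳ suc (n2 ↑ʳ suc (p ↑ˡ 1))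

      R : ℕ
      R = suc (n2 ℕ.+ suc (n3 ℕ.+ 1))

      στ : ∀ c → σ (τ c) ≡ c
      στ (p , suc (suc k)) =
        trans (cong σ1 (splitAt-↑ʳ n1 R (suc (combine p k ↑ˡ suc (n3 ℕ.+ 1)))))
         (trans (cong σ2 (splitAt-↑ˡ n2 (combine {M} {s2} p k) (suc (n3 ℕ.+ 1))))
           (cong (λ z → (proj₁ z , suc (suc (proj₂ z)))) (remQuot-combine {M} {s2} p k)))
      στ (zero , zero) = cong σ1 (splitAt-↑ʳ n1 R zero)
      στ (zero , suc zero) = trans (cong σ1 (splitAt-↑ʳ n1 R (suc (n2 ↑ʳ zero))))
                              (cong σ2 (splitAt-↑ʳ n2 (suc (n3 ℕ.+ 1)) zero))
      στ (suc p , suc zero) = cong σ1 (splitAt-↑ˡ n1 p R)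
      στ (suc zero , zero) = trans (cong σ1 (splitAt-↑ʳ n1 R (suc (n2 ↑ʳ suc (n3 ↑ʳ zero)))))
                              (trans (cong σ2 (splitAt-↑ʳ n2 (suc (n3 ℕ.+ 1)) (suc (n3 ↑ʳ zero))))
                                (cong σ3 (splitAt-↑ʳ n3 1 zero)))
      στ (suc (suc p) , zero) = trans (cong σ1 (splitAt-↑ʳ n1 R (suc (n2 ↑ʳ suc (p ↑ˡ 1)))))
                              (trans (cong σ2 (splitAt-↑ʳ n2 (suc (n3 ℕ.+ 1)) (suc (p ↑ˡ 1))))
                                (cong σ3 (splitAt-↑ˡ n3 p 1)))

      τσ3 : ∀ w → τ (σ3 w) ≡ n1 ↑ʳ suc (n2 ↑ʳ suc (join n3 1 w))
      τσ3 (inj₁ j) = refl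
      τσ3 (inj₂ zero) = refl

      τσ2 : ∀ w → τ (σ2 w) ≡ n1 ↑ʳ suc (join n2 (suc (n3 ℕ.+ 1)) w)
      τσ2 (inj₁ j) = cong (λ z → n1 ↑ʳ suc (z ↑ˡ suc (n3 ℕ.+ 1))) (combine-remQuot {M} s2 j)
      τσ2 (inj₂ zero) = refl
      τσ2 (inj₂ (suc r)) = trans (τσ3 (splitAt n3 r)) (cong (λ z → n1 ↑ʳ suc (n2 ↑ʳ suc z)) (join-splitAt n3 1 r))

      τσ1 : ∀ w → τ (σ1 w) ≡ join n1 (suc (n2 ℕ.+ suc (n3 ℕ.+ 1))) w
      τσ1 (inj₁ j) = refl
      τσ1 (inj₂ zero) = refl
      τσ1 (inj₂ (suc r)) = trans (τσ2 (splitAt n2 r)) (cong (λ z → n1 ↑ʳ suc z) (join-splitAt n2 (suc (n3 ℕ.+ 1)) r))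

      τσ : ∀ i → τ (σ i) ≡ i
      τσ i = trans (τσ1 (splitAt n1 i)) (join-splitAt n1 _ i)

      module Entries (o A T1 X T2 Y : ℤ) where
        L : List ℤ
        L = replicate n1 o ++ A ∷ replicate n2 T1 ++ X ∷ replicate n3 T2 ++ Y ∷ []

        diagonalEntry : C' → ℤ
        diagonalEntry (p , suc (suc k)) = T1
        diagonalEntry (zero , zero) = A
        diagonalEntry (zero , suc zero) = X
        diagonalEntry (suc p , suc zero) = o
        diagonalEntry (suc zero , zero) = Y
        diagonalEntry (suc (suc p) , zero) = T2

        L3 : List ℤ
        L3 = replicate n3 T2 ++ Y ∷ []
        L2 : List ℤ
        L2 = replicate n2 T1 ++ X ∷ L3

        nth3 : ∀ w → nth L3 (toℕ (join n3 1 w)) ≡ diagonalEntry (σ3 w)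
        nth3 (inj₁ j) = trans (cong (nth L3) (toℕ-↑ˡ j 1)) (nth-rep T2 (Y ∷ []) j)
        nth3 (inj₂ zero) = trans (cong (nth L3) (toℕ-↑ʳ n3 (zero {0}))) (nth-++ʳ n3 T2 (Y ∷ []) 0)

        nth2 : ∀ w → nth L2 (toℕ (join n2 (suc (n3 ℕ.+ 1)) w)) ≡ diagonalEntry (σ2 w)
        nth2 (inj₁ j) = trans (cong (nth L2) (toℕ-↑ˡ j (suc (n3 ℕ.+ 1)))) (nth-rep T1 (X ∷ L3) j)
        nth2 (inj₂ zero) = trans (cong (nth L2) (toℕ-↑ʳ n2 (zero {n3 ℕ.+ 1}))) (nth-++ʳ n2 T1 (X ∷ L3) 0)
        nth2 (inj₂ (suc r)) = trans (cong (nth L2) (toℕ-↑ʳ n2 (suc r)))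
                             (trans (nth-++ʳ n2 T1 (X ∷ L3) (suc (toℕ r)))
                               (trans (cong (nth L3) (cong toℕ (sym (join-splitAt n3 1 r)))) (nth3 (splitAt n3 r))))

        nth1 : ∀ w → nth L (toℕ (join n1 (suc (n2 ℕ.+ suc (n3 ℕ.+ 1))) w)) ≡ diagonalEntry (σ1 w)
        nth1 (inj₁ j) = trans (cong (nth L) (toℕ-↑ˡ j (suc (n2 ℕ.+ suc (n3 ℕ.+ 1))))) (nth-rep o (A ∷ L2) j)
        nth1 (inj₂ zero) = trans (cong (nth L) (toℕ-↑ʳ n1 (zero {n2 ℕ.+ suc (n3 ℕ.+ 1)}))) (nth-++ʳ n1 o (A ∷ L2) 0)
        nth1 (inj₂ (suc r)) = trans (cong (nth L) (toℕ-↑ʳ n1 (suc r)))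
                             (trans (nth-++ʳ n1 o (A ∷ L2) (suc (toℕ r)))
                               (trans (cong (nth L2) (cong toℕ (sym (join-splitAt n2 (suc (n3 ℕ.+ 1)) r)))) (nth2 (splitAt n2 r))))

        nthσ : ∀ i → nth L (toℕ i) ≡ diagonalEntry (σ i)
        nthσ i = trans (cong (nth L) (cong toℕ (sym (join-splitAt n1 _ i)))) (nth1 (splitAt n1 i))

      M*Sn≡K : M ℕ.* Sn ≡ K
      M*Sn≡K = lem m2 s2
        where lem : ∀ m2 s2 → suc (suc m2) ℕ.* suc (suc s2) ≡ suc m2 ℕ.+ suc (suc (suc m2) ℕ.* s2 ℕ.+ suc (m2 ℕ.+ 1))
              lem = NS.solve-∀

      ρ : Fin (M ℕ.* Sn) → C'
      ρ i = σ (cast M*Sn≡K i)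

      ρ⁻¹ : C' → Fin (M ℕ.* Sn)
      ρ⁻¹ c = cast (sym M*Sn≡K) (τ c)

      ρρ⁻¹ : ∀ c → ρ (ρ⁻¹ c) ≡ c
      ρρ⁻¹ c = trans (cong σ (cast-involutive M*Sn≡K (sym M*Sn≡K) (τ c))) (στ c)

      ρ⁻¹ρ : ∀ i → ρ⁻¹ (ρ i) ≡ i
      ρ⁻¹ρ i = trans (cong (cast (sym M*Sn≡K)) (τσ (cast M*Sn≡K i))) (cast-involutive (sym M*Sn≡K) M*Sn≡K i)

      open Flatten M Sn

      πf : Fin (M ℕ.* Sn) → Fin (M ℕ.* Sn)
      πf i = uncurry (combine {M} {Sn}) (ρ i)

      πf⁻¹ : Fin (M ℕ.* Sn) → Fin (M ℕ.* Sn)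
      πf⁻¹ x = ρ⁻¹ (remQuot {M} Sn x)

      γπ : ∀ i → γ (πf i) ≡ ρ i
      γπ i = remQuot-combine (proj₁ (ρ i)) (proj₂ (ρ i))

      πf⁻¹∘πf : ∀ x → πf⁻¹ (πf x) ≡ x
      πf⁻¹∘πf x = trans (cong ρ⁻¹ (γπ x)) (ρ⁻¹ρ x)

      πf∘πf⁻¹ : ∀ x → πf (πf⁻¹ x) ≡ x
      πf∘πf⁻¹ x = trans (cong (uncurry (combine {M} {Sn})) (ρρ⁻¹ (remQuot {M} Sn x))) (combine-remQuot {M} Sn x)

      eqbP-ρ : ∀ i j → eqbP (ρ i) (ρ j) ≡ δ i j
      eqbP-ρ i j = bool-ext
        (λ e → subst (λ z → δ i z ≡ true) (trans (sym (ρ⁻¹ρ i)) (trans (cong ρ⁻¹ (FiniteIndex.eqb-sound (pairIndex {M} {Sn}) (ρ i) (ρ j) e)) (ρ⁻¹ρ j))) (δ-refl i))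
        (λ e → subst (λ z → eqbP (ρ i) (ρ z) ≡ true) (δ-sound i j e) (FiniteIndex.eqb-refl (pairIndex {M} {Sn}) (ρ i)))

      module Diagonal (o A T1 X T2 Y : ℤ) where
        open Entries o A T1 X T2 Y

        diagonal : P.Mt
        diagonal r c = ind (eqbP r c) * diagonalEntry r

        ind*≡if : ∀ b (x : ℤ) → ind b * x ≡ (if b then x else + 0)
        ind*≡if true x = ℤP.*-identityˡ x
        ind*≡if false x = refl

        flatten-diagonal~diagL : flatten diagonal F.~ diagL L
        flatten-diagonal~diagL = F.~-trans {flatten diagonal} {λ i j → flatten diagonal (πf i) j} {diagL L} (F.rowPermute {flatten diagonal} πf πf⁻¹ πf⁻¹∘πf πf∘πf⁻¹)
                 (F.~-trans {λ i j → flatten diagonal (πf i) j} {λ i j → flatten diagonal (πf i) (πf j)} {diagL L}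
                   (F.colPermute {λ i j → flatten diagonal (πf i) j} πf πf⁻¹ πf⁻¹∘πf πf∘πf⁻¹)
                   (F.≑⇒~ {λ i j → flatten diagonal (πf i) (πf j)} {diagL L} flatten-diagonal∘πf))
          where
            flatten-diagonal∘πf : ∀ i j → flatten diagonal (πf i) (πf j) ≡ diagL L i j
            flatten-diagonal∘πf i j = trans (cong₂ diagonal (γπ i) (γπ j))
                       (trans (cong₂ (λ b x → ind b * x) (eqbP-ρ i j) (trans (sym (nthσ (cast M*Sn≡K i))) (cong (nth L) (toℕ-cast M*Sn≡K i))))
                         (ind*≡if (δ i j) (nth L (toℕ i))))

  module Transmission where

    open Equivalence
    open Flattening

    Σℕ-cong : ∀ {n} {f g : Fin n → ℕ} → (∀ k → f k ≡ g k) → Σℕ f ≡ Σℕ g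
    Σℕ-cong {zero} h = refl
    Σℕ-cong {suc n} h = cong₂ ℕ._+_ (h zero) (Σℕ-cong (λ k → h (suc k)))

    Σℕ-split : ∀ a {b} (f : Fin (a ℕ.+ b) → ℕ) → Σℕ f ≡ Σℕ (λ i → f (i ↑ˡ b)) ℕ.+ Σℕ (λ j → f (a ↑ʳ j))
    Σℕ-split zero f = refl
    Σℕ-split (suc a) {b} f rewrite Σℕ-split a (λ k → f (suc k)) = sym (ℕP.+-assoc (f zero) _ _)

    Σℕ-combine : ∀ m s (f : Fin (m ℕ.* s) → ℕ) → Σℕ f ≡ Σℕ {m} (λ q → Σℕ {s} (λ l → f (combine q l)))
    Σℕ-combine zero s f = refl
    Σℕ-combine (suc m) s f = trans (Σℕ-split s f) (cong (ℕ._+_ (Σℕ (λ i → f (i ↑ˡ (m ℕ.* s))))) (Σℕ-combine m s (λ k → f (s ↑ʳ k))))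

    Σℕ-const : ∀ {n} (c : ℕ) → Σℕ {n} (λ _ → c) ≡ n ℕ.* c
    Σℕ-const {zero} c = refl
    Σℕ-const {suc n} c = cong (c ℕ.+_) (Σℕ-const {n} c)

    Σℕ-ifδ : ∀ {n} (k : Fin (suc n)) (a b : ℕ) → Σℕ (λ l → if δ l k then a else b) ≡ a ℕ.+ n ℕ.* b
    Σℕ-ifδ {n} zero a b = cong (a ℕ.+_) (Σℕ-const {n} b)
    Σℕ-ifδ {suc n} (suc k) a b = trans (cong (b ℕ.+_) (Σℕ-ifδ k a b)) (lem a b n)
      where lem : ∀ a b n → b ℕ.+ (a ℕ.+ n ℕ.* b) ≡ a ℕ.+ suc n ℕ.* b
            lem = NS.solve-∀

    tOf-eq : ∀ m2 s2 → tOf (suc (suc m2)) (suc (suc s2)) ≡ suc (suc m2) ℕ.* suc (suc s2) ℕ.+ s2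
    tOf-eq m2 s2 = cong (_∸ 2) (trans (ℕP.+-suc (suc (suc m2) ℕ.* suc (suc s2)) (suc s2))
                       (cong suc (ℕP.+-suc (suc (suc m2) ℕ.* suc (suc s2)) s2)))

    walk-0⇒≡ : ∀ {n} {adj : Adj n} {u v} → Walk adj u v 0 → u ≡ v
    walk-0⇒≡ here = refl

    walk-1⇒adj : ∀ {n} {adj : Adj n} {u v} → Walk adj u v 1 → T (adj u v)
    walk-1⇒adj (step h here) = h

    ≤1⇒≡1 : ∀ {n} → n ≤ 1 → (n ≡ 0 → ⊥) → n ≡ 1
    ≤1⇒≡1 {zero} _ h = ⊥-elim (h refl)
    ≤1⇒≡1 {suc zero} _ _ = refl
    ≤1⇒≡1 {suc (suc n)} (s≤s ()) _

    ≤2⇒≡2 : ∀ {n} → n ≤ 2 → (n ≡ 0 → ⊥) → (n ≡ 1 → ⊥) → n ≡ 2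
    ≤2⇒≡2 {zero} _ h _ = ⊥-elim (h refl)
    ≤2⇒≡2 {suc zero} _ _ h = ⊥-elim (h refl)
    ≤2⇒≡2 {suc (suc zero)} _ _ _ = refl
    ≤2⇒≡2 {suc (suc (suc n))} (s≤s (s≤s ())) _ _

    module Multipartite (m2 s2 : ℕ) where
      M Sn : ℕ
      M = suc (suc m2)
      Sn = suc (suc s2)

      adj : Adj (M ℕ.* Sn)
      adj = multipartite M Sn

      γ : Fin (M ℕ.* Sn) → Fin M × Fin Sn
      γ = remQuot {M} Sn

      part : Fin (M ℕ.* Sn) → Fin M
      part i = proj₁ (γ i)

      other : Fin M → Fin M
      other zero = suc zero
      other (suc p) = zero

      δ-other : ∀ p → δ p (other p) ≡ false
      δ-other zero = refl
      δ-other (suc p) = refl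

      other-δ : ∀ p → δ (other p) p ≡ false
      other-δ zero = refl
      other-δ (suc p) = refl

      adj-differentParts : ∀ u v → δ (part u) (part v) ≡ false → T (adj u v)
      adj-differentParts u v e = subst (λ b → T (not b)) (sym e) tt

      multipartiteDistance : Fin (M ℕ.* Sn) → Fin (M ℕ.* Sn) → ℕ
      multipartiteDistance u v = if δ u v then 0 else (if δ (part u) (part v) then 2 else 1)

      module _ (d : Fin (M ℕ.* Sn) → Fin (M ℕ.* Sn) → ℕ) (isD : IsDistance adj d) where
        d≢0 : ∀ u v → δ u v ≡ false → d u v ≡ 0 → ⊥
        d≢0 u v e z with walk-0⇒≡ (subst (Walk adj u v) z (proj₁ (isD u v)))
        ... | refl = subst (λ b → b ≡ false → ⊥) (sym (δ-refl u)) (λ ()) e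

        d≡multipartiteDistance : ∀ u v → d u v ≡ multipartiteDistance u v
        d≡multipartiteDistance u v with δ u v in e
        ... | true with δ-sound u v e
        ...   | refl = ℕP.n≤0⇒n≡0 (proj₂ (isD u u) 0 here)
        d≡multipartiteDistance u v | false with δ (part u) (part v) in e2
        ... | false = ≤1⇒≡1 (proj₂ (isD u v) 1 (step (adj-differentParts u v e2) here)) (d≢0 u v e)
        ... | true = ≤2⇒≡2 (proj₂ (isD u v) 2 (step {w = w} h1 (step {w = v} h2 here))) (d≢0 u v e) d≢1
          where
            w : Fin (M ℕ.* Sn)
            w = combine {M} {Sn} (other (part u)) zero
            qw : part w ≡ other (part u)
            qw = cong proj₁ (remQuot-combine {M} {Sn} (other (part u)) zero)
            h1 : T (adj u w)
            h1 = adj-differentParts u w (trans (cong (δ (part u)) qw) (δ-other (part u)))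
            h2 : T (adj w v)
            h2 = adj-differentParts w v (trans (cong₂ δ qw (sym (δ-sound (part u) (part v) e2))) (other-δ (part u)))
            d≢1 : d u v ≡ 1 → ⊥
            d≢1 z = subst (λ b → T (not b)) e2 (walk-1⇒adj (subst (Walk adj u v) z (proj₁ (isD u v))))

        trs≡t : ∀ v → trs d v ≡ tOf M Sn
        trs≡t v =
          trans (Σℕ-cong (λ u → d≡multipartiteDistance u v))
           (trans (Σℕ-combine M Sn (λ u → multipartiteDistance u v))
            (trans (Σℕ-cong (λ q → Σℕ-cong (λ l → summand q l)))
             (trans (Σℕ-cong (λ q → partSum q))
              (trans (Σℕ-ifδ (proj₁ (γ v)) (0 ℕ.+ suc s2 ℕ.* 2) (Sn ℕ.* 1))
                (trans (lem m2 s2) (sym (tOf-eq m2 s2)))))))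
          where
            p = proj₁ (γ v)
            k = proj₂ (γ v)
            summand : ∀ q l → multipartiteDistance (combine q l) v ≡ (if δ q p ∧ δ l k then 0 else (if δ q p then 2 else 1))
            summand q l = cong₂ (λ b b' → if b then 0 else (if b' then 2 else 1))
                          (trans (δ-γ M Sn (combine q l) v) (cong (λ z → eqbP z (γ v)) (remQuot-combine {M} {Sn} q l)))
                          (cong (λ z → δ (proj₁ z) p) (remQuot-combine {M} {Sn} q l))
            partSum : ∀ q → Σℕ (λ l → if δ q p ∧ δ l k then 0 else (if δ q p then 2 else 1)) ≡ (if δ q p then 0 ℕ.+ suc s2 ℕ.* 2 else Sn ℕ.* 1)
            partSum q with δ q p
            ... | true = Σℕ-ifδ k 0 2
            ... | false = Σℕ-const {Sn} 1
            lem : ∀ m2 s2 → (0 ℕ.+ suc s2 ℕ.* 2) ℕ.+ suc m2 ℕ.* (suc (suc s2) ℕ.* 1) ≡ suc (suc m2) ℕ.* suc (suc s2) ℕ.+ s2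
            lem = NS.solve-∀

        module Chain = Reduction.Blocks.Chain m2 s2 (+ tOf M Sn)
        open Flatten M Sn using (flatten)

        Atrs≡flatten-A0 : ∀ i j → Atrs adj d i j ≡ flatten Chain.A0 i j
        Atrs≡flatten-A0 i j = trans (cong₂ (λ b T → (if b then + T else + 0) - (if not (δ (proj₁ (γ i)) (proj₁ (γ j))) then + 1 else + 0))
                              (δ-γ M Sn i j) (trs≡t i))
                            (lem (δ (proj₁ (γ i)) (proj₁ (γ j))) (δ (proj₂ (γ i)) (proj₂ (γ j))) (+ tOf M Sn))
          where lem : ∀ b1 b2 t → (if b1 ∧ b2 then t else + 0) - (if not b1 then + 1 else + 0) ≡ t * (ind b1 * ind b2) - (+ 1 - ind b1)
                lem true true t = l t
                  where l : ∀ t → t - + 0 ≡ t * (+ 1 * + 1) - (+ 1 - + 1)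
                        l = solve-∀
                lem true false t = l t
                  where l : ∀ t → + 0 - + 0 ≡ t * (+ 1 * + 0) - (+ 1 - + 1)
                        l = solve-∀
                lem false b2 t = l t (ind b2)
                  where l : ∀ t x → + 0 - + 1 ≡ t * (+ 0 * x) - (+ 1 - + 0)
                        l = solve-∀

  module Assembly where

    open Equivalence
    open Flattening

    module ForParts (m2 s2 : ℕ) where
      M Sn : ℕ
      M = suc (suc m2)
      Sn = suc (suc s2)
      tn : ℕ
      tn = tOf M Sn
      module Chain = Reduction.Blocks.Chain m2 s2 (+ tn)
      module Lay = Reordering.Layout m2 s2
      module G = Transmission.Multipartite m2 s2
      open Flatten M Sn using (γ; flatten; flatten-~; module F)

      module WithPivots (a x y u v w g ξ η U V h : ℤ)
                    (m-1≡a*u : Chain.m' ≡ a * u) (t-s[m-1]≡a*v : + tn - Chain.s * Chain.m' ≡ a * v) (t≡a*w : + tn ≡ a * w) (x*u+y*v≡1 : x * u + y * v ≡ + 1)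
                    (v≡g*V : v ≡ g * V) (u*s≡g*U : u * Chain.s ≡ g * U) (t+s≡g*h : + tn + Chain.s ≡ g * h) (ξ*V+η*U≡1 : ξ * V + η * U ≡ + 1) where
        module Pv = Chain.Pivots a x y u v w g ξ η U V h m-1≡a*u t-s[m-1]≡a*v t≡a*w x*u+y*v≡1 v≡g*V u*s≡g*U t+s≡g*h ξ*V+η*U≡1
        module Dg = Lay.Diagonal (+ 1) a (+ tn) (g * + tn) (+ tn * (+ tn + Chain.s)) (V * (+ tn * (+ tn + Chain.s)))

        diagonalList : List ℤ
        diagonalList = Lay.Entries.L (+ 1) a (+ tn) (g * + tn) (+ tn * (+ tn + Chain.s)) (V * (+ tn * (+ tn + Chain.s)))

        dval≡diagonalEntry : ∀ r → Pv.dval r ≡ Lay.Entries.diagonalEntry (+ 1) a (+ tn) (g * + tn) (+ tn * (+ tn + Chain.s)) (V * (+ tn * (+ tn + Chain.s))) r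
        dval≡diagonalEntry (p , suc (suc k)) = refl
        dval≡diagonalEntry (zero , zero) = refl
        dval≡diagonalEntry (zero , suc zero) = refl
        dval≡diagonalEntry (suc zero , zero) = refl
        dval≡diagonalEntry (suc (suc p) , zero) = refl
        dval≡diagonalEntry (suc p , suc zero) = refl

        Atrs~diagL : (d : Fin (M ℕ.* Sn) → Fin (M ℕ.* Sn) → ℕ) → IsDistance G.adj d →
                     ∃ λ P → ∃ λ Q → Unimodular P × Unimodular Q × ((P ⊗ Atrs G.adj d) ⊗ Q) ≐ diagL diagonalList
        Atrs~diagL d isD =
          F.~-trans {Atrs G.adj d} {flatten Chain.A0} {diagL diagonalList} (F.≑⇒~ {Atrs G.adj d} {flatten Chain.A0} (G.Atrs≡flatten-A0 d isD))
           (F.~-trans {flatten Chain.A0} {flatten Pv.D} {diagL diagonalList} (flatten-~ {Chain.A0} {Pv.D} Pv.A0~D)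
             (F.~-trans {flatten Pv.D} {flatten Dg.diagonal} {diagL diagonalList}
                (F.≑⇒~ {flatten Pv.D} {flatten Dg.diagonal} (λ i j → cong (ind (eqbP (γ i) (γ j)) *_) (dval≡diagonalEntry (γ i))))
                Dg.flatten-diagonal~diagL))

  module Parameters where

    open Equivalence
    open Flattening
    open Assembly

    parity : ∀ n → (Σ ℕ λ k → n ≡ k ℕ.* 2) ⊎ (Σ ℕ λ k → n ≡ suc (k ℕ.* 2))
    parity zero = inj₁ (0 , refl)
    parity (suc n) with parity n
    ... | inj₁ (k , e) = inj₂ (k , cong suc e)
    ... | inj₂ (k , e) = inj₁ (suc k , cong suc e)

    even≢odd : ∀ k j → k ℕ.* 2 ≡ suc (j ℕ.* 2) → ⊥
    even≢odd zero j ()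
    even≢odd (suc k) zero ()
    even≢odd (suc k) (suc j) e = even≢odd k j (ℕP.suc-injective (ℕP.suc-injective e))

    odd*odd : ∀ a b → suc (a ℕ.* 2) ℕ.* suc (b ℕ.* 2) ≡ suc ((a ℕ.+ b ℕ.+ a ℕ.* b ℕ.* 2) ℕ.* 2)
    odd*odd = NS.solve-∀

    divBy[m*n,n]≡m : ∀ x a → a ≢ 0 → divBy (x ℕ.* a) a ≡ x
    divBy[m*n,n]≡m x zero h = ⊥-elim (h refl)
    divBy[m*n,n]≡m x (suc a) h = m*n/n≡m x (suc a)

    module Cases (m2 s2 : ℕ) where
      open ForParts m2 s2
      an : ℕ
      an = aOf M Sn

      a∣m-1 : an ∣ suc m2
      a∣m-1 = gcd[m,n]∣m (suc m2) (2 ℕ.* suc s2)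
      a∣2[s-1] : an ∣ 2 ℕ.* suc s2
      a∣2[s-1] = gcd[m,n]∣n (suc m2) (2 ℕ.* suc s2)
      a≢0 : an ≢ 0
      a≢0 = gcd[m,n]≢0 (suc m2) (2 ℕ.* suc s2) (inj₁ (λ ()))

      un vn : ℕ
      un = _∣_.quotient a∣m-1
      vn = _∣_.quotient a∣2[s-1]
      m-1≡u*a : suc m2 ≡ un ℕ.* an
      m-1≡u*a = _∣_.equality a∣m-1
      2[s-1]≡v*a : 2 ℕ.* suc s2 ≡ vn ℕ.* an
      2[s-1]≡v*a = _∣_.equality a∣2[s-1]

      instance
        a-nonZero : NonZero an
        a-nonZero = ℕ.≢-nonZero a≢0

      -- the Bézout identity for m − 1 and 2 (s − 1), divided by their gcd a
      bezout-uv : Σ ℤ λ x → Σ ℤ λ y → x * + un + y * + vn ≡ + 1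
      bezout-uv with Bézout.identity (gcd-GCD (suc m2) (2 ℕ.* suc s2))
      ... | Bézout.Identity.+- x' y' eq = + x' , - (+ y') , fin
        where
          c : 1 ℕ.+ y' ℕ.* vn ≡ x' ℕ.* un
          c = ℕP.*-cancelʳ-≡ (1 ℕ.+ y' ℕ.* vn) (x' ℕ.* un) an
                (trans (l1 an y' vn) (trans (cong (λ z → an ℕ.+ y' ℕ.* z) (sym 2[s-1]≡v*a)) (trans eq (trans (cong (x' ℕ.*_) m-1≡u*a) (l2 x' un an)))))
            where l1 : ∀ a y v → (1 ℕ.+ y ℕ.* v) ℕ.* a ≡ a ℕ.+ y ℕ.* (v ℕ.* a)
                  l1 = NS.solve-∀
                  l2 : ∀ x u a → x ℕ.* (u ℕ.* a) ≡ x ℕ.* u ℕ.* a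
                  l2 = NS.solve-∀
          fin : + x' * + un + - (+ y') * + vn ≡ + 1
          fin = trans (cong (_+ (- (+ y') * + vn)) (trans (sym (ℤP.pos-* x' un)) (trans (cong +_ (sym c)) (trans (ℤP.pos-+ 1 (y' ℕ.* vn)) (cong (_+_ (+ 1)) (ℤP.pos-* y' vn))))))
                      (l (+ y') (+ vn))
            where l : ∀ y v → (+ 1 + y * v) + - y * v ≡ + 1
                  l = solve-∀
      ... | Bézout.Identity.-+ x' y' eq = - (+ x') , + y' , fin
        where
          c : 1 ℕ.+ x' ℕ.* un ≡ y' ℕ.* vn
          c = ℕP.*-cancelʳ-≡ (1 ℕ.+ x' ℕ.* un) (y' ℕ.* vn) an
                (trans (l1 an x' un) (trans (cong (λ z → an ℕ.+ x' ℕ.* z) (sym m-1≡u*a)) (trans eq (trans (cong (y' ℕ.*_) 2[s-1]≡v*a) (l2 y' vn an)))))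
            where l1 : ∀ a y v → (1 ℕ.+ y ℕ.* v) ℕ.* a ≡ a ℕ.+ y ℕ.* (v ℕ.* a)
                  l1 = NS.solve-∀
                  l2 : ∀ x u a → x ℕ.* (u ℕ.* a) ≡ x ℕ.* u ℕ.* a
                  l2 = NS.solve-∀
          fin : - (+ x') * + un + + y' * + vn ≡ + 1
          fin = trans (cong (_+_ (- (+ x') * + un)) (trans (sym (ℤP.pos-* y' vn)) (trans (cong +_ (sym c)) (trans (ℤP.pos-+ 1 (x' ℕ.* un)) (cong (_+_ (+ 1)) (ℤP.pos-* x' un))))))
                      (l (+ x') (+ un))
            where l : ∀ x u → - x * u + (+ 1 + x * u) ≡ + 1
                  l = solve-∀

      x y : ℤ
      x = proj₁ bezout-uv
      y = proj₁ (proj₂ bezout-uv)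
      x*u+y*v≡1 : x * + un + y * + vn ≡ + 1
      x*u+y*v≡1 = proj₂ (proj₂ bezout-uv)

      t≡m*s+s-2 : + tn ≡ (+ 2 + + m2) * (+ 2 + + s2) + + s2
      t≡m*s+s-2 = trans (cong +_ (Transmission.tOf-eq m2 s2)) (trans (ℤP.pos-+ (M ℕ.* Sn) s2) (cong (_+ + s2) (ℤP.pos-* M Sn)))

      m-1≡a*u : Chain.m' ≡ + an * + un
      m-1≡a*u = trans (cong +_ m-1≡u*a) (trans (ℤP.pos-* un an) (ℤP.*-comm (+ un) (+ an)))

      a*v≡2[1+s2] : + an * + vn ≡ + 2 * (+ 1 + + s2)
      a*v≡2[1+s2] = trans (ℤP.*-comm (+ an) (+ vn)) (trans (sym (ℤP.pos-* vn an)) (trans (cong +_ (sym 2[s-1]≡v*a)) (ℤP.pos-* 2 (suc s2))))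

      t-s[m-1]≡a*v : + tn - Chain.s * Chain.m' ≡ + an * + vn
      t-s[m-1]≡a*v = trans (cong (λ T → T - Chain.s * Chain.m') t≡m*s+s-2) (trans (l m2 s2) (sym a*v≡2[1+s2]))
        where l : ∀ m2 s2 → ((+ 2 + + m2) * (+ 2 + + s2) + + s2) - (+ 2 + + s2) * (+ 1 + + m2) ≡ + 2 * (+ 1 + + s2)
              l m2 s2 = lem (+ m2) (+ s2)
                where lem : ∀ m s → ((+ 2 + m) * (+ 2 + s) + s) - (+ 2 + s) * (+ 1 + m) ≡ + 2 * (+ 1 + s)
                      lem = solve-∀

      w : ℤ
      w = + un * Chain.s + + vn

      t≡a*w : + tn ≡ + an * w
      t≡a*w = trans (l (+ tn) Chain.s Chain.m') (trans (cong₂ (λ P Q → P * Chain.s + Q) m-1≡a*u t-s[m-1]≡a*v) (l2 (+ an) (+ un) (+ vn) Chain.s))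
        where l : ∀ t s m → t ≡ m * s + (t - s * m)
              l = solve-∀
              l2 : ∀ a u v s → a * u * s + a * v ≡ a * (u * s + v)
              l2 = solve-∀

      snfShape : ℕ → ℤ → ℤ → ℤ → ℤ → ℤ → ℤ → List ℤ
      snfShape n2 o A T1 X T2 Y = replicate (suc m2) o ++ A ∷ replicate n2 T1 ++ X ∷ replicate m2 T2 ++ Y ∷ []

      ms-2m≡m[s-2] : M ℕ.* Sn ∸ 2 ℕ.* M ≡ M ℕ.* s2
      ms-2m≡m[s-2] = trans (cong (_∸ 2 ℕ.* M) (l m2 s2)) (ℕP.m+n∸m≡n (2 ℕ.* M) (M ℕ.* s2))
        where l : ∀ m2 s2 → suc (suc m2) ℕ.* suc (suc s2) ≡ 2 ℕ.* suc (suc m2) ℕ.+ suc (suc m2) ℕ.* s2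
              l = NS.solve-∀

      snfShape-cong : ∀ {n n' X X' T2 T2' Y Y'} o A T1 → n ≡ n' → X ≡ X' → T2 ≡ T2' → Y ≡ Y' →
            snfShape n o A T1 X T2 Y ≡ snfShape n' o A T1 X' T2' Y'
      snfShape-cong o A T1 refl refl refl refl = refl

      length-replicate++ : ∀ n (x : ℤ) ys → length (replicate n x ++ ys) ≡ n ℕ.+ length ys
      length-replicate++ zero x ys = refl
      length-replicate++ (suc n) x ys = cong suc (length-replicate++ n x ys)

      length-snfShape : ∀ o A T1 X T2 Y → length (snfShape (M ℕ.* Sn ∸ 2 ℕ.* M) o A T1 X T2 Y) ≡ M ℕ.* Sn
      length-snfShape o A T1 X T2 Y = begin
          length (snfShape (M ℕ.* Sn ∸ 2 ℕ.* M) o A T1 X T2 Y)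
        ≡⟨ length-replicate++ (suc m2) o _ ⟩
          suc m2 ℕ.+ suc (length (replicate (M ℕ.* Sn ∸ 2 ℕ.* M) T1 ++ X ∷ replicate m2 T2 ++ Y ∷ []))
        ≡⟨ cong (λ z → suc m2 ℕ.+ suc z) (length-replicate++ (M ℕ.* Sn ∸ 2 ℕ.* M) T1 _) ⟩
          suc m2 ℕ.+ suc (M ℕ.* Sn ∸ 2 ℕ.* M ℕ.+ suc (length (replicate m2 T2 ++ Y ∷ [])))
        ≡⟨ cong₂ (λ n z → suc m2 ℕ.+ suc (n ℕ.+ suc z)) ms-2m≡m[s-2] (length-replicate++ m2 T2 (Y ∷ [])) ⟩
          suc m2 ℕ.+ suc (M ℕ.* s2 ℕ.+ suc (m2 ℕ.+ 1))
        ≡⟨ l m2 s2 ⟩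
          M ℕ.* Sn
        ∎
        where
          open ≡-Reasoning
          l : ∀ m2 s2 → suc m2 ℕ.+ suc (suc (suc m2) ℕ.* s2 ℕ.+ suc (m2 ℕ.+ 1)) ≡ suc (suc m2) ℕ.* suc (suc s2)
          l = NS.solve-∀

      NonNegative : ℤ → Set
      NonNegative z = + 0 ℤ.≤ z

      All-replicate : ∀ n (a : ℕ) ys → All NonNegative ys → All NonNegative (replicate n (+ a) ++ ys)
      All-replicate zero a ys h = h
      All-replicate (suc n) a ys h = ℤ.+≤+ z≤n ∷ All-replicate n a ys h

      All-snfShape : ∀ n2 (o A T1 X T2 Y : ℕ) → All NonNegative (snfShape n2 (+ o) (+ A) (+ T1) (+ X) (+ T2) (+ Y))
      All-snfShape n2 o A T1 X T2 Y = All-replicate (suc m2) o _ (ℤ.+≤+ z≤n ∷ All-replicate n2 T1 _ (ℤ.+≤+ z≤n ∷ All-replicate m2 T2 _ (ℤ.+≤+ z≤n ∷ [])))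

      Linked-replicate : ∀ (w : ℕ) n (x z : ℕ) rest → w ∣ x → w ∣ z → x ∣ x → x ∣ z → Linked _∣ℤ_ (+ z ∷ rest) →
                  Linked _∣ℤ_ (+ w ∷ replicate n (+ x) ++ + z ∷ rest)
      Linked-replicate w zero x z rest wx wz xx xz L = wz ∷ L
      Linked-replicate w (suc n) x z rest wx wz xx xz L = wx ∷ Linked-replicate x n x z rest xx xz xx xz L

      Linked-snfShape : ∀ n2 (o A T1 X T2 Y : ℕ) → o ∣ o → o ∣ A → A ∣ T1 → A ∣ X → T1 ∣ T1 → T1 ∣ X →
               X ∣ T2 → X ∣ Y → T2 ∣ T2 → T2 ∣ Y → Linked _∣ℤ_ (snfShape n2 (+ o) (+ A) (+ T1) (+ X) (+ T2) (+ Y))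
      Linked-snfShape n2 o A T1 X T2 Y oo oA AT AX TT TX XT XY T2T2 T2Y =
        Linked-replicate o m2 o A _ oo oA oo oA (Linked-replicate A n2 T1 X _ AT AX TT TX (Linked-replicate X m2 T2 Y [] XT XY T2T2 T2Y [-]))

      a∣t : an ∣ tn
      a∣t = divides (un ℕ.* Sn ℕ.+ vn) (trans (Transmission.tOf-eq m2 s2) (trans (l m2 s2)
              (trans (cong₂ (λ P Q → P ℕ.* Sn ℕ.+ Q) m-1≡u*a 2[s-1]≡v*a) (l2 un an Sn vn))))
        where l : ∀ m2 s2 → suc (suc m2) ℕ.* suc (suc s2) ℕ.+ s2 ≡ suc m2 ℕ.* suc (suc s2) ℕ.+ 2 ℕ.* suc s2
              l = NS.solve-∀
              l2 : ∀ u a s v → u ℕ.* a ℕ.* s ℕ.+ v ℕ.* a ≡ (u ℕ.* s ℕ.+ v) ℕ.* a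
              l2 = NS.solve-∀

      t[t+s]≡T : + tn * (+ tn + Chain.s) ≡ + (tn ℕ.* (tn ℕ.+ Sn))
      t[t+s]≡T = sym (trans (ℤP.pos-* tn (tn ℕ.+ Sn)) (cong (+ tn *_) (ℤP.pos-+ tn Sn)))

      2∣2+n⇒even : ∀ {n} → 2 ∣ suc (suc n) → Σ ℕ λ k → n ≡ k ℕ.* 2
      2∣2+n⇒even (divides zero ())
      2∣2+n⇒even (divides (suc q) e) = q , ℕP.suc-injective (ℕP.suc-injective e)

      Tn : ℕ
      Tn = tn ℕ.* (tn ℕ.+ Sn)

      record SecondPivot : Set where
        field
          g V h : ℕ
          U ξ η : ℤ
          v≡g*V : + vn ≡ + g * + V
          u*s≡g*U : + un * Chain.s ≡ + g * U
          t+s≡g*h : tn ℕ.+ Sn ≡ g ℕ.* h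
          ξ*V+η*U≡1 : ξ * + V + η * U ≡ + 1

      snfList : SecondPivot → List ℤ
      snfList P = snfShape (M ℕ.* Sn ∸ 2 ℕ.* M) (+ 1) (+ an) (+ tn) (+ (g ℕ.* tn)) (+ Tn) (+ (V ℕ.* Tn))
        where open SecondPivot P

      Atrs-isSNF : (P : SecondPivot) (d : Fin (M ℕ.* Sn) → Fin (M ℕ.* Sn) → ℕ) → IsDistance (multipartite M Sn) d →
                   IsSNF (Atrs (multipartite M Sn) d) (snfList P)
      Atrs-isSNF P d isD =
        length-snfShape _ _ _ _ _ _ ,
        All-snfShape _ _ _ _ _ _ _ ,
        Linked-snfShape _ 1 an tn (g ℕ.* tn) Tn (V ℕ.* Tn)
          (1∣ 1) (1∣ an) a∣t (∣-trans a∣t t∣g*t) ∣-refl t∣g*t g*t∣T (∣-trans g*t∣T T∣V*T) ∣-refl T∣V*T ,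
        subst (λ L → ∃ λ P → ∃ λ Q → Unimodular P × Unimodular Q × ((P ⊗ Atrs (multipartite M Sn) d) ⊗ Q) ≐ diagL L)
          diagonalList≡snfList (W.Atrs~diagL d isD)
        where
          open SecondPivot P
          module W = ForParts.WithPivots m2 s2 (+ an) x y (+ un) (+ vn) w (+ g) ξ η U (+ V) (+ h)
                       m-1≡a*u t-s[m-1]≡a*v t≡a*w x*u+y*v≡1 v≡g*V u*s≡g*U (trans (cong +_ t+s≡g*h) (ℤP.pos-* g h)) ξ*V+η*U≡1
          diagonalList≡snfList : W.diagonalList ≡ snfList P
          diagonalList≡snfList = snfShape-cong (+ 1) (+ an) (+ tn) (sym ms-2m≡m[s-2]) (sym (ℤP.pos-* g tn)) t[t+s]≡T
                                   (trans (cong (+ V *_) t[t+s]≡T) (sym (ℤP.pos-* V Tn)))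
          t∣g*t : tn ∣ g ℕ.* tn
          t∣g*t = divides g refl
          g*t∣T : g ℕ.* tn ∣ Tn
          g*t∣T = divides h (trans (cong (tn ℕ.*_) t+s≡g*h) (l tn g h))
            where l : ∀ t g h → t ℕ.* (g ℕ.* h) ≡ h ℕ.* (g ℕ.* t)
                  l = NS.solve-∀
          T∣V*T : Tn ∣ V ℕ.* Tn
          T∣V*T = divides V refl

      -- When m and s are even, v = 2 (s − 1) / a is even since a divides the odd number m − 1.
      module EvenCase (ev : 2 ∣ M × 2 ∣ Sn) where
        m₀ s₀ : ℕ
        m₀ = proj₁ (2∣2+n⇒even (proj₁ ev))
        s₀ = proj₁ (2∣2+n⇒even (proj₂ ev))

        m-2≡m₀*2 : m2 ≡ m₀ ℕ.* 2
        m-2≡m₀*2 = proj₂ (2∣2+n⇒even (proj₁ ev))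

        s-2≡s₀*2 : s2 ≡ s₀ ℕ.* 2
        s-2≡s₀*2 = proj₂ (2∣2+n⇒even (proj₂ ev))

        v-even : Σ ℕ λ V₀ → vn ≡ V₀ ℕ.* 2
        v-even with parity vn
        ... | inj₁ r = r
        ... | inj₂ (k , v≡2k+1) with parity an
        ...   | inj₁ (j , ea) = ⊥-elim (even≢odd (un ℕ.* j) m₀
                   (sym (trans (cong suc (sym m-2≡m₀*2)) (trans m-1≡u*a (trans (cong (un ℕ.*_) ea) (sym (ℕP.*-assoc un j 2)))))))
        ...   | inj₂ (j , ea) = ⊥-elim (even≢odd (suc s2) (k ℕ.+ j ℕ.+ k ℕ.* j ℕ.* 2)
                   (trans (ℕP.*-comm (suc s2) 2) (trans 2[s-1]≡v*a (trans (cong₂ ℕ._*_ v≡2k+1 ea) (odd*odd k j)))))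

        V₀ : ℕ
        V₀ = proj₁ v-even

        v≡V₀*2 : vn ≡ V₀ ℕ.* 2
        v≡V₀*2 = proj₂ v-even

        a*V₀≡s-1 : an ℕ.* V₀ ≡ suc s2
        a*V₀≡s-1 = ℕP.*-cancelʳ-≡ (an ℕ.* V₀) (suc s2) 2
          (trans (l an V₀) (trans (cong (ℕ._* an) (sym v≡V₀*2)) (trans (sym 2[s-1]≡v*a) (ℕP.*-comm 2 (suc s2)))))
          where l : ∀ a V → a ℕ.* V ℕ.* 2 ≡ V ℕ.* 2 ℕ.* a
                l = NS.solve-∀

        s-2≡s₀*2ℤ : + s2 ≡ + s₀ * + 2
        s-2≡s₀*2ℤ = trans (cong +_ s-2≡s₀*2) (ℤP.pos-* s₀ 2)

        h₀ : ℕ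
        h₀ = s₀ ℕ.* (4 ℕ.+ m2) ℕ.+ (3 ℕ.+ m2)

        t+s≡2*h₀ : tn ℕ.+ Sn ≡ 2 ℕ.* h₀
        t+s≡2*h₀ = trans (cong (ℕ._+ Sn) (Transmission.tOf-eq m2 s2))
          (trans (cong (λ z → suc (suc m2) ℕ.* suc (suc z) ℕ.+ z ℕ.+ suc (suc z)) s-2≡s₀*2) (l m2 s₀))
          where l : ∀ m2 s → suc (suc m2) ℕ.* suc (suc (s ℕ.* 2)) ℕ.+ s ℕ.* 2 ℕ.+ suc (suc (s ℕ.* 2)) ≡ 2 ℕ.* (s ℕ.* (4 ℕ.+ m2) ℕ.+ (3 ℕ.+ m2))
                l = NS.solve-∀

        U₀ : ℤ
        U₀ = + un * (+ 1 + + s₀)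

        u*s≡2*U₀ : + un * Chain.s ≡ + 2 * U₀
        u*s≡2*U₀ = trans (cong (λ z → + un * (+ 2 + z)) s-2≡s₀*2ℤ) (l (+ un) (+ s₀))
          where l : ∀ u s → u * (+ 2 + s * + 2) ≡ + 2 * (u * (+ 1 + s))
                l = solve-∀

        ξ*V₀+η*U₀≡1 : (+ 4 * y * (+ 1 + + s₀) - + an) * + V₀ + (+ 2 * x) * U₀ ≡ + 1
        ξ*V₀+η*U₀≡1 = trans (l x y (+ un) (+ V₀) (+ s₀) (+ an))
          (trans (cong₂ (λ P Q → (+ 2 * (+ 1 + + s₀)) * P - Q) x*u+y*[2V₀]≡1 a*V₀≡1+2s₀) (l2 (+ s₀)))
          where
            l : ∀ x y u V s a → (+ 4 * y * (+ 1 + s) - a) * V + (+ 2 * x) * (u * (+ 1 + s)) ≡ (+ 2 * (+ 1 + s)) * (x * u + y * (+ 2 * V)) - a * V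
            l = solve-∀
            l2 : ∀ s → (+ 2 * (+ 1 + s)) * + 1 - (+ 1 + s * + 2) ≡ + 1
            l2 = solve-∀
            x*u+y*[2V₀]≡1 : x * + un + y * (+ 2 * + V₀) ≡ + 1
            x*u+y*[2V₀]≡1 = trans (cong (λ z → x * + un + y * z) (sym (trans (cong +_ v≡V₀*2) (trans (ℤP.pos-* V₀ 2) (ℤP.*-comm (+ V₀) (+ 2)))))) x*u+y*v≡1
            a*V₀≡1+2s₀ : + an * + V₀ ≡ + 1 + + s₀ * + 2
            a*V₀≡1+2s₀ = trans (sym (ℤP.pos-* an V₀)) (trans (cong +_ a*V₀≡s-1) (cong (_+_ (+ 1)) s-2≡s₀*2ℤ))

        pivot : SecondPivot
        pivot = record
          { g = 2 ; V = V₀ ; h = h₀ ; U = U₀ ; ξ = + 4 * y * (+ 1 + + s₀) - + an ; η = + 2 * x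
          ; v≡g*V = trans (cong +_ v≡V₀*2) (trans (ℤP.pos-* V₀ 2) (ℤP.*-comm (+ V₀) (+ 2)))
          ; u*s≡g*U = u*s≡2*U₀ ; t+s≡g*h = t+s≡2*h₀ ; ξ*V+η*U≡1 = ξ*V₀+η*U₀≡1 }

        lastEntry : divBy (suc s2 ℕ.* tn ℕ.* (tn ℕ.+ Sn)) an ≡ V₀ ℕ.* Tn
        lastEntry = trans (cong (λ z → divBy z an) (trans (cong (λ z → z ℕ.* tn ℕ.* (tn ℕ.+ Sn)) (sym a*V₀≡s-1)) (l an V₀ tn (tn ℕ.+ Sn))))
                      (divBy[m*n,n]≡m (V₀ ℕ.* Tn) an a≢0)
          where l : ∀ a V t u → a ℕ.* V ℕ.* t ℕ.* u ≡ V ℕ.* (t ℕ.* u) ℕ.* a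
                l = NS.solve-∀

      module OddCase (ne : ¬ (2 ∣ M × 2 ∣ Sn)) where
        a*v≡2[s-1] : + an * + vn ≡ + 2 * (Chain.s - + 1)
        a*v≡2[s-1] = trans a*v≡2[1+s2] (l (+ s2))
          where l : ∀ s → + 2 * (+ 1 + s) ≡ + 2 * ((+ 2 + s) - + 1)
                l = solve-∀

        coprime-v-s-odd : ∀ k → Sn ≡ suc (k ℕ.* 2) → Σ ℤ λ α → Σ ℤ λ β → α * + vn + β * Chain.s ≡ + 1
        coprime-v-s-odd k e = + k * + an , + 1 - + 2 * + k ,
          trans (l (+ k) (+ an) (+ vn) Chain.s) (trans (cong (λ z → + k * z + (+ 1 - + 2 * + k) * Chain.s) a*v≡2[s-1])
            (trans (l2 (+ k) Chain.s) (trans (cong (λ z → z - + 2 * + k) s≡1+2k) (l3 (+ k)))))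
          where
            l : ∀ k a v s → k * a * v + (+ 1 - + 2 * k) * s ≡ k * (a * v) + (+ 1 - + 2 * k) * s
            l = solve-∀
            l2 : ∀ k s → k * (+ 2 * (s - + 1)) + (+ 1 - + 2 * k) * s ≡ s - + 2 * k
            l2 = solve-∀
            l3 : ∀ k → (+ 1 + k * + 2) - + 2 * k ≡ + 1
            l3 = solve-∀
            s≡1+2k : Chain.s ≡ + 1 + + k * + 2
            s≡1+2k = trans (cong +_ e) (trans (ℤP.pos-+ 1 (k ℕ.* 2)) (cong (_+_ (+ 1)) (ℤP.pos-* k 2)))

        -- If s is even then m is odd, so a is even and v = (s − 1) / (a / 2) is odd.
        v-odd-if-s-even : ∀ s' → Sn ≡ s' ℕ.* 2 → Σ ℕ λ k → vn ≡ suc (k ℕ.* 2)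
        v-odd-if-s-even s' es' with parity M | parity vn
        ... | inj₁ (j , e) | _ = ⊥-elim (ne (divides j e , divides s' es'))
        ... | inj₂ _ | inj₂ r = r
        ... | inj₂ (j , e) | inj₁ (k , v≡2k) = ⊥-elim (even≢odd (k ℕ.* a') s₀
                 (sym (trans (cong suc (sym s-2≡s₀*2)) (trans s-1≡v*a' (trans (cong (ℕ._* a') v≡2k) (l k a'))))))
          where
            2∣a : 2 ∣ an
            2∣a = gcd-greatest (divides j (ℕP.suc-injective e)) (divides (suc s2) (ℕP.*-comm 2 (suc s2)))
            a' = _∣_.quotient 2∣a
            s₀ = proj₁ (2∣2+n⇒even (divides s' es'))
            s-2≡s₀*2 : s2 ≡ s₀ ℕ.* 2
            s-2≡s₀*2 = proj₂ (2∣2+n⇒even (divides s' es'))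
            s-1≡v*a' : suc s2 ≡ vn ℕ.* a'
            s-1≡v*a' = ℕP.*-cancelʳ-≡ (suc s2) (vn ℕ.* a') 2
              (trans (ℕP.*-comm (suc s2) 2) (trans 2[s-1]≡v*a (trans (cong (vn ℕ.*_) (_∣_.equality 2∣a)) (sym (ℕP.*-assoc vn a' 2)))))
            l : ∀ k a → k ℕ.* 2 ℕ.* a ≡ k ℕ.* a ℕ.* 2
            l = NS.solve-∀

        coprime-v-s-even : ∀ s' → Sn ≡ s' ℕ.* 2 → Σ ℤ λ α → Σ ℤ λ β → α * + vn + β * Chain.s ≡ + 1
        coprime-v-s-even s' es' = + 1 + + k * + an , - (+ 2 * + k) ,
          trans (l (+ k) (+ an) (+ vn) Chain.s) (trans (cong (λ z → + vn + + k * z - + 2 * + k * Chain.s) a*v≡2[s-1])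
            (trans (l2 (+ k) Chain.s (+ vn)) (trans (cong (λ z → z - + 2 * + k) v≡1+2k) (l3 (+ k)))))
          where
            k = proj₁ (v-odd-if-s-even s' es')
            v≡1+2k : + vn ≡ + 1 + + k * + 2
            v≡1+2k = trans (cong +_ (proj₂ (v-odd-if-s-even s' es'))) (trans (ℤP.pos-+ 1 (k ℕ.* 2)) (cong (_+_ (+ 1)) (ℤP.pos-* k 2)))
            l : ∀ k a v s → (+ 1 + k * a) * v + (- (+ 2 * k)) * s ≡ v + k * (a * v) - + 2 * k * s
            l = solve-∀
            l2 : ∀ k s v → v + k * (+ 2 * (s - + 1)) - + 2 * k * s ≡ v - + 2 * k
            l2 = solve-∀
            l3 : ∀ k → (+ 1 + k * + 2) - + 2 * k ≡ + 1
            l3 = solve-∀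

        coprime-v-s : Σ ℤ λ α → Σ ℤ λ β → α * + vn + β * Chain.s ≡ + 1
        coprime-v-s with parity Sn
        ... | inj₁ (s' , e) = coprime-v-s-even s' e
        ... | inj₂ (k , e) = coprime-v-s-odd k e

        α β : ℤ
        α = proj₁ coprime-v-s
        β = proj₁ (proj₂ coprime-v-s)

        ξ*v+η*[u*s]≡1 : (α + β * Chain.s * y) * + vn + (β * x) * (+ un * Chain.s) ≡ + 1
        ξ*v+η*[u*s]≡1 = trans (l α β x y (+ un) (+ vn) Chain.s) (trans (cong (λ z → α * + vn + β * Chain.s * z) x*u+y*v≡1)
          (trans (cong (_+_ (α * + vn)) (ℤP.*-identityʳ (β * Chain.s))) (proj₂ (proj₂ coprime-v-s))))
          where l : ∀ α β x y u v s → (α + β * s * y) * v + (β * x) * (u * s) ≡ α * v + β * s * (x * u + y * v)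
                l = solve-∀

        pivot : SecondPivot
        pivot = record
          { g = 1 ; V = vn ; h = tn ℕ.+ Sn ; U = + un * Chain.s ; ξ = α + β * Chain.s * y ; η = β * x
          ; v≡g*V = sym (ℤP.*-identityˡ (+ vn)) ; u*s≡g*U = sym (ℤP.*-identityˡ (+ un * Chain.s))
          ; t+s≡g*h = sym (ℕP.*-identityˡ (tn ℕ.+ Sn)) ; ξ*V+η*U≡1 = ξ*v+η*[u*s]≡1 }

        lastEntry : divBy (2 ℕ.* suc s2 ℕ.* tn ℕ.* (tn ℕ.+ Sn)) an ≡ vn ℕ.* Tn
        lastEntry = trans (cong (λ z → divBy z an) (trans (cong (λ z → z ℕ.* tn ℕ.* (tn ℕ.+ Sn)) 2[s-1]≡v*a) (l an vn tn (tn ℕ.+ Sn))))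
                      (divBy[m*n,n]≡m (vn ℕ.* Tn) an a≢0)
          where l : ∀ a V t u → V ℕ.* a ℕ.* t ℕ.* u ≡ V ℕ.* (t ℕ.* u) ℕ.* a
                l = NS.solve-∀

      evenSNF : (2 ∣ M × 2 ∣ Sn) → (d : Fin (M ℕ.* Sn) → Fin (M ℕ.* Sn) → ℕ) → IsDistance (multipartite M Sn) d →
                IsSNF (Atrs (multipartite M Sn) d) (snfEven M Sn)
      evenSNF ev d isD = subst (IsSNF (Atrs (multipartite M Sn) d))
        (cong (λ Y → snfShape (M ℕ.* Sn ∸ 2 ℕ.* M) (+ 1) (+ an) (+ tn) (+ (2 ℕ.* tn)) (+ Tn) (+ Y)) (sym (EvenCase.lastEntry ev)))
        (Atrs-isSNF (EvenCase.pivot ev) d isD)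

      otherSNF : ¬ (2 ∣ M × 2 ∣ Sn) → (d : Fin (M ℕ.* Sn) → Fin (M ℕ.* Sn) → ℕ) → IsDistance (multipartite M Sn) d →
                 IsSNF (Atrs (multipartite M Sn) d) (snfOther M Sn)
      otherSNF ne d isD = subst (IsSNF (Atrs (multipartite M Sn) d))
        (cong₂ (λ X Y → snfShape (M ℕ.* Sn ∸ 2 ℕ.* M) (+ 1) (+ an) (+ tn) (+ X) (+ Tn) (+ Y)) (ℕP.*-identityˡ tn) (sym (OddCase.lastEntry ne)))
        (Atrs-isSNF (OddCase.pivot ne) d isD)

open import Data.Nat using (ℕ; _≤_; _*_; zero; suc; s≤s; z≤n)
open import Data.Nat.Divisibility using (_∣_)
open import Data.Fin using (Fin)
open import Data.Product using (_×_; _,_)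
open import Relation.Nullary using (¬_)

mainTheorem12 : (m s : ℕ) → 2 ≤ m → 2 ≤ s →
    (d : Fin (m * s) → Fin (m * s) → ℕ) → IsDistance (multipartite m s) d →
    ((2 ∣ m × 2 ∣ s) → IsSNF (Atrs (multipartite m s) d) (snfEven m s)) ×
    (¬ (2 ∣ m × 2 ∣ s) → IsSNF (Atrs (multipartite m s) d) (snfOther m s))
mainTheorem12 (suc (suc m2)) (suc (suc s2)) (s≤s (s≤s z≤n)) (s≤s (s≤s z≤n)) d isD =
  (λ ev → Parameters.Cases.evenSNF m2 s2 ev d isD) , (λ ne → Parameters.Cases.otherSNF m2 s2 ne d isD)
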